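{- For all non-negative integers $n,k,\ell$, we have $L_1(n,k,\ell)=A(n,k,\ell)$, where $L_1(n,k,\ell)$ and $A(n,k,\ell)$ are as defined in the context.
   Context: A two-color partition of $n$ is a finite multiset of positive integers summing to $n$ (listed in non-increasing order), where each part carries one of two colors, red or green; a part of value $a$ and color red (resp. green) is written $a_r$ (resp. $a_g$). Two parts are numerically distinct if they have different numerical values. For an integer $d\ge 1$, let $\mathcal{L}_d(n)$ be the set of two-color partitions $\lambda_1>\lambda_2>\cdots>\lambda_m$ of $n$ into numerically distinct parts such that: (1) each red part $\lambda_i$ with $i<m$ satisfies $\lambda_i-\lambda_{i+1}\ge d$; (2) each green part $\lambda_i$ with $i<m$ satisfies $\lambda_i-\lambda_{i+1}\ge d+1$; (3) neither $1_g$ nor $(d-1)_g$ occurs as a part. Let $L_d(n,k,\ell)$ be the number of partitions in $\mathcal{L}_d(n)$ with exactly $k$ red parts and exactly $\ell$ green parts. Let $A(n,k,\ell)$ be the number of two-color partitions of $n$ consisting of $k+j$ pairwise distinct red parts (for some integer $j\ge 0$) and $\ell$ pairwise distinct even green parts, such that exactly $k$ of the red parts are larger than $\ell$. -}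

module Defs where

open import Data.Nat using (ℕ; zero; suc; _+_; _∸_; _≤_; _<_; _≤?_; _<?_)
open import Data.Nat.Properties using (_≟_)
open import Data.Nat.Base using (_%_)
open import Data.Nat.ListAction using (sum)
open import Data.List using (List; []; _∷_; _++_; map; length; filter; cartesianProduct)
open import Data.List.Relation.Unary.All using (All; all?)
open import Data.List.Relation.Unary.Linked using (Linked; linked?)
open import Data.Product using (_×_; _,_; proj₁; proj₂)
open import Data.Product.Properties using (≡-dec)
open import Relation.Nullary using (Dec; yes; no; ¬_; ¬?)
open import Relation.Nullary.Decidable using (_×-dec_)
open import Relation.Binary.PropositionalEquality using (_≡_; _≢_; refl)

data Color : Set where
  red green : Color

_≟ᶜ_ : (a b : Color) → Dec (a ≡ b)
red   ≟ᶜ red   = yes refl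
red   ≟ᶜ green = no λ ()
green ≟ᶜ red   = no λ ()
green ≟ᶜ green = yes refl

CPart : Set
CPart = ℕ × Color

value : CPart → ℕ
value = proj₁

color : CPart → Color
color = proj₂

_≟ᵖ_ : (p q : CPart) → Dec (p ≡ q)
_≟ᵖ_ = ≡-dec _≟_ _≟ᶜ_

-- The set 𝓛_d(n) with k red and ℓ green parts.
-- A partition λ₁ > λ₂ > ⋯ > λ_m is the list [λ₁ , … , λ_m] of coloured
-- parts, listed with numerically strictly decreasing values.

GapC : ℕ → Color → ℕ → ℕ → Set
GapC d red   a b = b + d ≤ a
GapC d green a b = b + suc d ≤ a

gapC? : ∀ d c a b → Dec (GapC d c a b)
gapC? d red   a b = (b + d) ≤? a
gapC? d green a b = (b + suc d) ≤? a

Gap : ℕ → CPart → CPart → Set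
Gap d p q = (value q < value p) × GapC d (color p) (value p) (value q)

gap? : ∀ d p q → Dec (Gap d p q)
gap? d p q = (value q <? value p) ×-dec gapC? d (color p) (value p) (value q)

PartOK : ℕ → CPart → Set
PartOK d p = (1 ≤ value p) × (p ≢ (1 , green)) × (p ≢ (d ∸ 1 , green))

partOK? : ∀ d p → Dec (PartOK d p)
partOK? d p = (1 ≤? value p) ×-dec (¬? (p ≟ᵖ (1 , green)) ×-dec ¬? (p ≟ᵖ (d ∸ 1 , green)))

IsRed : CPart → Set
IsRed p = color p ≡ red

IsGreen : CPart → Set
IsGreen p = color p ≡ green

numRed : List CPart → ℕ
numRed ps = length (filter (λ p → color p ≟ᶜ red) ps)

numGreen : List CPart → ℕ
numGreen ps = length (filter (λ p → color p ≟ᶜ green) ps)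

IsL : ℕ → ℕ → ℕ → ℕ → List CPart → Set
IsL d n k ℓ ps =
  All (PartOK d) ps × Linked (Gap d) ps ×
  (sum (map value ps) ≡ n) × (numRed ps ≡ k) × (numGreen ps ≡ ℓ)

isL? : ∀ d n k ℓ ps → Dec (IsL d n k ℓ ps)
isL? d n k ℓ ps =
  all? (partOK? d) ps ×-dec (linked? (gap? d) ps ×-dec
  ((sum (map value ps) ≟ n) ×-dec ((numRed ps ≟ k) ×-dec (numGreen ps ≟ ℓ))))

colouredSubsets : ℕ → List (List CPart)
colouredSubsets zero    = [] ∷ []
colouredSubsets (suc b) =
  colouredSubsets b
  ++ map ((suc b , red) ∷_) (colouredSubsets b)
  ++ map ((suc b , green) ∷_) (colouredSubsets b)

-- L_d(n,k,ℓ): every element of 𝓛_d(n) has all parts ≤ n, hence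
-- occurs exactly once among the candidates colouredSubsets n.
L : ℕ → ℕ → ℕ → ℕ → ℕ
L d n k ℓ = length (filter (isL? d n k ℓ) (colouredSubsets n))

-- A(n,k,ℓ): a partition is a pair (reds , greens) of lists of values,
-- each listed in strictly decreasing order (so parts of each colour are
-- pairwise distinct).

StrictDec : List ℕ → Set
StrictDec = Linked (λ a b → b < a)

Even : ℕ → Set
Even a = a % 2 ≡ 0

IsA : ℕ → ℕ → ℕ → List ℕ × List ℕ → Set
IsA n k ℓ (rs , gs) =
  All (1 ≤_) rs × StrictDec rs ×
  All (1 ≤_) gs × StrictDec gs × All Even gs ×
  (sum rs + sum gs ≡ n) ×
  (length gs ≡ ℓ) ×
  (length (filter (ℓ <?_) rs) ≡ k)

isA? : ∀ n k ℓ x → Dec (IsA n k ℓ x)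
isA? n k ℓ (rs , gs) =
  all? (1 ≤?_) rs ×-dec (linked? (λ a b → b <? a) rs ×-dec
  (all? (1 ≤?_) gs ×-dec (linked? (λ a b → b <? a) gs ×-dec
  (all? (λ a → (a % 2) ≟ 0) gs ×-dec
  (((sum rs + sum gs) ≟ n) ×-dec
  ((length gs ≟ ℓ) ×-dec (length (filter (ℓ <?_) rs) ≟ k)))))))

subsets : ℕ → List (List ℕ)
subsets zero    = [] ∷ []
subsets (suc b) = subsets b ++ map (suc b ∷_) (subsets b)

A : ℕ → ℕ → ℕ → ℕ
A n k ℓ = length (filter (isA? n k ℓ) (cartesianProduct (subsets n) (subsets n)))

-- Both sides satisfy, with X(0,0;n) = [n = 0], the recurrence
--   X(k,ℓ;n) = X(k,ℓ;n−k−ℓ) + X(k,ℓ−1;n−2(k+ℓ)) + X(k−1,ℓ;n−k−ℓ),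
-- which determines them.  For 𝓛₁, classify by the smallest part: if it is 1ᵣ (resp. 2_g),
-- delete it and subtract 1 (resp. 2) from every other part; otherwise subtract 1 from
-- every part.  For A, lowering by one the k red parts above ℓ (after deleting ℓ+1 if it is
-- a red part) gives A(k,ℓ;n) = A(k,ℓ;n−k) + A(k−1,ℓ;n−k−ℓ).  Lowering every green part by 2,
-- after deleting a smallest green part 2 (which lowers the threshold to ℓ−1, so the red
-- parts are then treated as before), gives after telescoping
-- A(k,ℓ;n) = A(k,ℓ;n−ℓ) + A(k,ℓ−1;n−k−2ℓ).  Substituting this into the first identity
-- yields the recurrence.
module Submission where

open import Defs
open import Data.Nat using (ℕ; zero; suc; pred; _+_; _*_; _∸_; _≤_; _<_; _≤?_; _<?_; z≤n; s≤s; z<s; >-nonZero)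
open import Data.Nat.Properties
open import Data.Nat.Induction using (<-rec)
open import Data.Nat.Tactic.RingSolver using (solve-∀)
open import Algebra.Properties.CommutativeSemigroup +-commutativeSemigroup using (x∙yz≈y∙xz; interchange)
open import Data.Nat.ListAction using (sum)
open import Data.Nat.ListAction.Properties using (sum-++; sum-↭)
open import Data.List.Relation.Binary.Permutation.Propositional as ↭ using (_↭_; prep; swap; ↭-sym)
open import Data.List.Relation.Binary.Permutation.Propositional.Properties
  using (filter-↭; ↭-length; All-resp-↭; ∈-resp-↭)
open import Data.List using (List; []; _∷_; _++_; _∷ʳ_; map; length; filter; last; cartesianProduct)
open import Data.List.Properties
  using (filter-none; filter-accept; filter-reject; filter-++; length-map; length-++; map-++; map-∘; map-id-local; ∷-injectiveʳ)
open import Data.List.Relation.Unary.All.Properties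
  using (¬Any⇒All¬) renaming (map⁺ to All-map⁺; map⁻ to All-map⁻; ∷ʳ⁺ to All-∷ʳ⁺; ∷ʳ⁻ to All-∷ʳ⁻)
open import Data.List.Relation.Unary.All as All using (All; []; _∷_)
open import Data.List.Relation.Unary.Any using (here; there)
open import Data.List.Relation.Unary.Unique.Propositional using (Unique; []; _∷_)
open import Data.List.Relation.Unary.Unique.Propositional.Properties using (filter⁺; cartesianProduct⁺)
  renaming (++⁺ to Unique-++⁺; map⁺ to Unique-map-injective⁺)
open import Data.List.Relation.Unary.Linked as Linked using (Linked; []; [-]; _∷_)
open import Data.List.Relation.Unary.Linked.Properties using (Linked⇒AllPairs)
open import Data.List.Relation.Binary.Disjoint.Propositional using (Disjoint)
open import Data.List.Relation.Binary.Subset.Propositional using (_⊆_)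
open import Data.List.Membership.Propositional using (_∈_; _∉_)
open import Data.List.Membership.DecPropositional _≟_ using (_∈?_)
open import Data.List.Membership.Propositional.Properties
  using (∈-filter⁺; ∈-filter⁻; ∈-map⁺; ∈-map⁻; ∈-++⁺ˡ; ∈-++⁺ʳ; ∈-++⁻; ∈-cartesianProduct⁺)
open import Data.Maybe using (just)
open import Data.Maybe.Properties using () renaming (≡-dec to ≡-dec-Maybe)
open import Function using (_∘_; id)
open import Data.Sum using (inj₁; inj₂)
open import Data.Product using (∃-syntax; _×_; _,_; proj₁; proj₂)
open import Data.Empty using (⊥)
open import Relation.Nullary using (yes; no; ¬_; contradiction)
open import Level using (0ℓ)
open import Relation.Unary using (Pred; Decidable; ∁; _∩_) renaming (_⊆_ to _⊆ᵖ_)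
open import Relation.Unary.Properties using (_∩?_; ∁?)
open import Relation.Binary.PropositionalEquality
open import Relation.Binary.Definitions using (DecidableEquality)

private variable
  X Y : Set

Decreasing : (X → ℕ) → List X → Set
Decreasing v = Linked (λ p q → v q < v p)

Decreasing-head : ∀ {v : X → ℕ} {x xs} → Decreasing v (x ∷ xs) → All (λ q → v q < v x) xs
Decreasing-head dec with Linked⇒AllPairs (λ q<p r<q → <-trans r<q q<p) dec
... | below ∷ _ = below

Decreasing-tail-≤ : ∀ {v : X → ℕ} {x xs b} → Decreasing v (x ∷ xs) → v x ≤ suc b → All (λ q → v q ≤ b) xs
Decreasing-tail-≤ dec vx≤1+b = All.map (λ vq<vx → ≤-pred (≤-trans vq<vx vx≤1+b)) (Decreasing-head dec)

Decreasing-∷ : ∀ {v : X → ℕ} {x xs} → All (λ q → v q < v x) xs → Decreasing v xs → Decreasing v (x ∷ xs)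
Decreasing-∷ []        [] = [-]
Decreasing-∷ (vy<vx ∷ _) dec = vy<vx ∷ dec

Decreasing-above-last : ∀ {v : X → ℕ} ys {x} → Decreasing v (ys ∷ʳ x) → All (λ y → v x < v y) ys
Decreasing-above-last []       _   = []
Decreasing-above-last (y ∷ ys) dec =
  proj₂ (All-∷ʳ⁻ (Decreasing-head dec)) ∷ Decreasing-above-last ys (Linked.tail dec)

Linked-map⁺ : ∀ {R : X → X → Set} {S : Y → Y → Set} {P : Pred X 0ℓ} {xs} (f : X → Y) →
  (∀ {p q} → P p → P q → R p q → S (f p) (f q)) → All P xs → Linked R xs → Linked S (map f xs)
Linked-map⁺ f step _                []           = []
Linked-map⁺ f step _                [-]          = [-]
Linked-map⁺ f step (Pp ∷ Pqs@(Pq ∷ _)) (Rpq ∷ Rqs) = step Pp Pq Rpq ∷ Linked-map⁺ f step Pqs Rqs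

init : List X → List X
init []           = []
init (x ∷ [])     = []
init (x ∷ y ∷ xs) = x ∷ init (y ∷ xs)

init-∷ʳ : ∀ (xs : List X) {x} → init (xs ∷ʳ x) ≡ xs
init-∷ʳ []           = refl
init-∷ʳ (y ∷ [])     = refl
init-∷ʳ (y ∷ z ∷ xs) = cong (y ∷_) (init-∷ʳ (z ∷ xs))

last-∷ʳ : ∀ (xs : List X) {x} → last (xs ∷ʳ x) ≡ just x
last-∷ʳ []           = refl
last-∷ʳ (y ∷ [])     = refl
last-∷ʳ (y ∷ z ∷ xs) = last-∷ʳ (z ∷ xs)

init-∷ʳ-last : ∀ (xs : List X) {x} → last xs ≡ just x → init xs ∷ʳ x ≡ xs
init-∷ʳ-last (y ∷ [])     refl = refl
init-∷ʳ-last (y ∷ z ∷ xs) eq   = cong (y ∷_) (init-∷ʳ-last (z ∷ xs) eq)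

last-map⁻ : ∀ (f : X → Y) (xs : List X) {y} → last (map f xs) ≡ just y → ∃[ x ] last xs ≡ just x × f x ≡ y
last-map⁻ f (x ∷ [])     refl = x , refl , refl
last-map⁻ f (x ∷ z ∷ xs) eq   = last-map⁻ f (z ∷ xs) eq

last-∈ : ∀ (xs : List X) {x} → last xs ≡ just x → x ∈ xs
last-∈ (y ∷ [])     refl = here refl
last-∈ (y ∷ z ∷ xs) eq   = there (last-∈ (z ∷ xs) eq)

Linked-∷ʳ⁻ : ∀ {R : X → X → Set} (xs : List X) {x} → Linked R (xs ∷ʳ x) → Linked R xs
Linked-∷ʳ⁻ []               _          = []
Linked-∷ʳ⁻ (y ∷ [])         _          = [-]
Linked-∷ʳ⁻ (y ∷ z ∷ xs) (Ryz ∷ Rxs) = Ryz ∷ Linked-∷ʳ⁻ (z ∷ xs) Rxs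

Linked-∷ʳ⁺ : ∀ {R : X → X → Set} {xs : List X} {x} →
  Linked R xs → (∀ {y} → last xs ≡ just y → R y x) → Linked R (xs ∷ʳ x)
Linked-∷ʳ⁺ []          Rlast = [-]
Linked-∷ʳ⁺ [-]         Rlast = Rlast refl ∷ [-]
Linked-∷ʳ⁺ (Ryz ∷ Rxs) Rlast = Ryz ∷ Linked-∷ʳ⁺ Rxs Rlast

EndsWith : X → List X → Set
EndsWith x xs = last xs ≡ just x

endsWith? : DecidableEquality X → ∀ x → Decidable (EndsWith x)
endsWith? _≟_ x xs = ≡-dec-Maybe _≟_ (last xs) (just x)

All-≤-sum : (xs : List ℕ) → All (_≤ sum xs) xs
All-≤-sum []       = []
All-≤-sum (x ∷ xs) = m≤m+n x (sum xs) ∷ All.map (λ y≤ → ≤-trans y≤ (m≤n+m (sum xs) x)) (All-≤-sum xs)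

sum-map-+ : ∀ s xs → sum (map (s +_) xs) ≡ s * length xs + sum xs
sum-map-+ s []       = sym (cong (_+ 0) (*-zeroʳ s))
sum-map-+ s (x ∷ xs) = trans (cong (s + x +_) (sum-map-+ s xs)) (rearrange s x (length xs) (sum xs))
  where
  rearrange : ∀ s x m t → s + x + (s * m + t) ≡ s * suc m + (x + t)
  rearrange = solve-∀

-- Counting along enumerations

count : {P : Pred X 0ℓ} → Decidable P → List X → ℕ
count P? xs = length (filter P? xs)

count-accept : {P : Pred X 0ℓ} (P? : Decidable P) {x : X} (xs : List X) → P x → count P? (x ∷ xs) ≡ suc (count P? xs)
count-accept P? xs Px = cong length (filter-accept P? Px)

count-reject : {P : Pred X 0ℓ} (P? : Decidable P) {x : X} (xs : List X) → ¬ P x → count P? (x ∷ xs) ≡ count P? xs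
count-reject P? xs ¬Px = cong length (filter-reject P? ¬Px)

count-split : {P C : Pred X 0ℓ} (P? : Decidable P) (C? : Decidable C) (xs : List X) →
  count P? xs ≡ count (P? ∩? C?) xs + count (P? ∩? ∁? C?) xs
count-split P? C? [] = refl
count-split P? C? (x ∷ xs) with P? x | C? x
... | yes _ | yes _ = cong suc (count-split P? C? xs)
... | yes _ | no _  = trans (cong suc (count-split P? C? xs)) (sym (+-suc _ _))
... | no _  | yes _ = count-split P? C? xs
... | no _  | no _  = count-split P? C? xs

count-none : {P : Pred X 0ℓ} (P? : Decidable P) (xs : List X) → (∀ x → ¬ P x) → count P? xs ≡ 0
count-none P? xs none = cong length (filter-none P? (All.universal none xs))

count-map : {P : Pred Y 0ℓ} (P? : Decidable P) (f : X → Y) (xs : List X) →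
  count P? (map f xs) ≡ count (λ x → P? (f x)) xs
count-map P? f []       = refl
count-map P? f (x ∷ xs) with P? (f x)
... | yes _ = cong suc (count-map P? f xs)
... | no _  = count-map P? f xs

count-cong-local : {P Q : Pred X 0ℓ} (P? : Decidable P) (Q? : Decidable Q) {xs : List X} →
  All (λ x → (P x → Q x) × (Q x → P x)) xs → count P? xs ≡ count Q? xs
count-cong-local P? Q? {[]}     []                = refl
count-cong-local P? Q? {x ∷ xs} ((P⇒Q , Q⇒P) ∷ eqs) with P? x | Q? x
... | yes _  | yes _  = cong suc (count-cong-local P? Q? eqs)
... | yes Px | no ¬Qx = contradiction (P⇒Q Px) ¬Qx
... | no ¬Px | yes Qx = contradiction (Q⇒P Qx) ¬Px
... | no _   | no _   = count-cong-local P? Q? eqs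

count-++ : {P : Pred X 0ℓ} (P? : Decidable P) (xs ys : List X) → count P? (xs ++ ys) ≡ count P? xs + count P? ys
count-++ P? xs ys = trans (cong length (filter-++ P? xs ys)) (length-++ (filter P? xs))

count-↭ : {P : Pred X 0ℓ} (P? : Decidable P) {xs ys : List X} → xs ↭ ys → count P? xs ≡ count P? ys
count-↭ P? xs↭ys = ↭-length (filter-↭ P? xs↭ys)

_─_ : {x : X} (ys : List X) → x ∈ ys → List X
(y ∷ ys) ─ here _    = ys
(y ∷ ys) ─ there x∈ = y ∷ (ys ─ x∈)

length-─ : {x : X} (ys : List X) (x∈ : x ∈ ys) → length ys ≡ suc (length (ys ─ x∈))
length-─ (y ∷ ys) (here _)   = refl
length-─ (y ∷ ys) (there x∈) = cong suc (length-─ ys x∈)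

∈-─ : {x z : X} (ys : List X) (x∈ : x ∈ ys) → z ∈ ys → z ≢ x → z ∈ ys ─ x∈
∈-─ (y ∷ ys) (here refl) (here refl) z≢x = contradiction refl z≢x
∈-─ (y ∷ ys) (here _)    (there z∈)  _   = z∈
∈-─ (y ∷ ys) (there _)   (here z≡y)  _   = here z≡y
∈-─ (y ∷ ys) (there x∈)  (there z∈)  z≢x = there (∈-─ ys x∈ z∈ z≢x)

Unique-⊆⇒length≤ : {xs ys : List X} → Unique xs → xs ⊆ ys → length xs ≤ length ys
Unique-⊆⇒length≤ {xs = []} [] _ = z≤n
Unique-⊆⇒length≤ {xs = x ∷ xs} {ys} (x∉xs ∷ uniq) xs⊆ys = begin
  suc (length xs)         ≤⟨ s≤s (Unique-⊆⇒length≤ uniq rest⊆) ⟩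
  suc (length (ys ─ x∈))  ≡⟨ length-─ ys x∈ ⟨
  length ys               ∎
  where
  open ≤-Reasoning
  x∈ = xs⊆ys (here refl)
  distinct : ∀ {z zs} → All (x ≢_) zs → z ∈ zs → z ≢ x
  distinct (x≢z ∷ _) (here refl) z≡x = x≢z (sym z≡x)
  distinct (_ ∷ ne) (there z∈)   z≡x = distinct ne z∈ z≡x
  rest⊆ : xs ⊆ ys ─ x∈
  rest⊆ z∈ = ∈-─ ys x∈ (xs⊆ys (there z∈)) (distinct x∉xs z∈)

Unique-map⁺ : {xs : List X} (f : X → Y) → Unique xs →
  (∀ {a b} → a ∈ xs → b ∈ xs → f a ≡ f b → a ≡ b) → Unique (map f xs)
Unique-map⁺ {xs = []} f [] _ = []
Unique-map⁺ {xs = x ∷ xs} f (x∉xs ∷ uniq) inj =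
  fresh x∉xs (λ b∈ → inj (here refl) (there b∈)) ∷ Unique-map⁺ f uniq (λ a∈ b∈ → inj (there a∈) (there b∈))
  where
  fresh : ∀ {ys} → All (x ≢_) ys → (∀ {b} → b ∈ ys → f x ≡ f b → x ≡ b) → All (f x ≢_) (map f ys)
  fresh []         _   = []
  fresh (x≢y ∷ ne) inj′ = (λ e → x≢y (inj′ (here refl) e)) ∷ fresh ne (λ b∈ → inj′ (there b∈))

Enumerates : Pred X 0ℓ → List X → Set
Enumerates P xs = Unique xs × P ⊆ᵖ (_∈ xs)

count-≤ : {P : Pred X 0ℓ} {Q : Pred Y 0ℓ} (P? : Decidable P) (Q? : Decidable Q) {xs : List X} {ys : List Y} →
  Unique xs → Q ⊆ᵖ (_∈ ys) → (f : X → Y) (g : Y → X) →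
  (∀ {x} → P x → Q (f x)) → (∀ {x} → P x → g (f x) ≡ x) → count P? xs ≤ count Q? ys
count-≤ P? Q? {xs} {ys} uniq complete f g f-maps g∘f = begin
  count P? xs                ≡⟨ length-map f (filter P? xs) ⟨
  length (map f (filter P? xs)) ≤⟨ Unique-⊆⇒length≤ (Unique-map⁺ f (filter⁺ P? uniq) injective) image⊆ ⟩
  count Q? ys                ∎
  where
  open ≤-Reasoning
  injective : ∀ {a b} → a ∈ filter P? xs → b ∈ filter P? xs → f a ≡ f b → a ≡ b
  injective {a} {b} a∈ b∈ fa≡fb = trans (sym (g∘f (proj₂ (∈-filter⁻ P? {xs = xs} a∈))))
    (trans (cong g fa≡fb) (g∘f (proj₂ (∈-filter⁻ P? {xs = xs} b∈))))
  image⊆ : map f (filter P? xs) ⊆ filter Q? ys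
  image⊆ y∈ with ∈-map⁻ f y∈
  ... | x , x∈ , refl = let Qfx = f-maps (proj₂ (∈-filter⁻ P? {xs = xs} x∈)) in ∈-filter⁺ Q? (complete Qfx) Qfx

-- Lagged sequences and the recurrence

-- lag s f n is f (n − s), but 0 (rather than f 0) when s > n.
lag : ℕ → (ℕ → ℕ) → ℕ → ℕ
lag zero    f n       = f n
lag (suc s) f zero    = 0
lag (suc s) f (suc n) = lag s f n

lag-+ : ∀ s f j → lag s f (s + j) ≡ f j
lag-+ zero    f j = refl
lag-+ (suc s) f j = lag-+ s f j

lag-> : ∀ s f n → n < s → lag s f n ≡ 0
lag-> (suc s) f zero    _         = refl
lag-> (suc s) f (suc n) (s≤s n<s) = lag-> s f n n<s

lag-lag : ∀ a b f n → lag a (lag b f) n ≡ lag (a + b) f n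
lag-lag zero    b f n       = refl
lag-lag (suc a) b f zero    = refl
lag-lag (suc a) b f (suc n) = lag-lag a b f n

lag-distrib-+ : ∀ s f g n → lag s (λ j → f j + g j) n ≡ lag s f n + lag s g n
lag-distrib-+ zero    f g n       = refl
lag-distrib-+ (suc s) f g zero    = refl
lag-distrib-+ (suc s) f g (suc n) = lag-distrib-+ s f g n

lag-cong : ∀ s {f g} n → (∀ j → f j ≡ g j) → lag s f n ≡ lag s g n
lag-cong zero    n       f≗g = f≗g n
lag-cong (suc s) zero    f≗g = refl
lag-cong (suc s) (suc n) f≗g = lag-cong s n f≗g

lag-cong-< : ∀ s {f g} n → 1 ≤ s → (∀ j → j < n → f j ≡ g j) → lag s f n ≡ lag s g n
lag-cong-< (suc s)       zero    _ _  = refl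
lag-cong-< (suc zero)    (suc n) _ eq = eq n ≤-refl
lag-cong-< (suc (suc s)) (suc n) _ eq = lag-cong-< (suc s) n (s≤s z≤n) (λ j j<n → eq j (m≤n⇒m≤1+n j<n))

-- Q j describes the objects of weight j; a lowering is a bijection from P onto Q (n ∸ s).
record Lowering (P : Pred X 0ℓ) (Q : ℕ → Pred Y 0ℓ) (s n : ℕ) : Set where
  field
    to        : X → Y
    from      : Y → X
    to-maps   : ∀ {x} → P x → ∃[ j ] n ≡ s + j × Q j (to x)
    from-maps : ∀ {j y} → n ≡ s + j → Q j y → P (from y)
    from∘to   : ∀ {x} → P x → from (to x) ≡ x
    to∘from   : ∀ {j y} → n ≡ s + j → Q j y → to (from y) ≡ y

count-lowering : ∀ {s n} {P : Pred X 0ℓ} {Q : ℕ → Pred Y 0ℓ} (P? : Decidable P) (Q? : ∀ j → Decidable (Q j))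
  {xs : List X} {ys : ℕ → List Y} → Enumerates P xs → (∀ j → Enumerates (Q j) (ys j)) →
  Lowering P Q s n → count P? xs ≡ lag s (λ j → count (Q? j) (ys j)) n
count-lowering {s = s} {n} {P = P} {Q = Q} P? Q? {xs} {ys} (uniqP , completeP) enumQ low with s ≤? n
... | no s≰n = trans (count-none P? xs (λ x Px → s≰n (weight-≥ (to-maps Px))))
                     (sym (lag-> s _ n (≰⇒> s≰n)))
  where
  open Lowering low
  weight-≥ : ∀ {x} → (∃[ j ] n ≡ s + j × Q j (to x)) → s ≤ n
  weight-≥ (j , n≡s+j , _) = subst (s ≤_) (sym n≡s+j) (m≤m+n s j)
... | yes s≤n = begin
  count P? xs                 ≡⟨ ≤-antisym (count-≤ P? (Q? j) uniqP completeQ to from to-maps′ from∘to)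
                                           (count-≤ (Q? j) P? uniqQ completeP from to (from-maps n≡s+j) (to∘from n≡s+j)) ⟩
  count (Q? j) (ys j)         ≡⟨ lag-+ s _ j ⟨
  lag s _ (s + j)             ≡⟨ cong (lag s _) n≡s+j ⟨
  lag s _ n                   ∎
  where
  open Lowering low
  open ≡-Reasoning
  j = n ∸ s
  n≡s+j : n ≡ s + j
  n≡s+j = sym (m+[n∸m]≡n s≤n)
  uniqQ = proj₁ (enumQ j)
  completeQ = proj₂ (enumQ j)
  to-maps′ : ∀ {x} → P x → Q j (to x)
  to-maps′ Px with to-maps Px
  ... | j′ , n≡s+j′ , Qto = subst (λ i → Q i (to _)) (+-cancelˡ-≡ s j′ j (trans (sym n≡s+j′) n≡s+j)) Qto

Lowering-⇔ : ∀ {s n} {P P′ : Pred X 0ℓ} {Q Q′ : ℕ → Pred Y 0ℓ} →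
  (∀ {x} → P x → P′ x) → (∀ {x} → P′ x → P x) → (∀ {j y} → Q j y → Q′ j y) → (∀ {j y} → Q′ j y → Q j y) →
  Lowering P′ Q′ s n → Lowering P Q s n
Lowering-⇔ P⇒P′ P′⇒P Q⇒Q′ Q′⇒Q low = record
  { to        = to
  ; from      = from
  ; to-maps   = λ Px → let (j , n≡ , Q′j) = to-maps (P⇒P′ Px) in j , n≡ , Q′⇒Q Q′j
  ; from-maps = λ n≡ Qjy → P′⇒P (from-maps n≡ (Q⇒Q′ Qjy))
  ; from∘to   = from∘to ∘ P⇒P′
  ; to∘from   = λ n≡ Qjy → to∘from n≡ (Q⇒Q′ Qjy)
  }
  where open Lowering low

-- X k ℓ n stands for L₁(n,k,ℓ) or A(n,k,ℓ), with n last so that X k ℓ can be lagged.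
Family : Set
Family = ℕ → ℕ → ℕ → ℕ

greenTerm : Family → ℕ → ℕ → ℕ → ℕ
greenTerm X k zero    n = 0
greenTerm X k (suc ℓ) n = lag (2 * (k + suc ℓ)) (X k ℓ) n

redTerm : Family → ℕ → ℕ → ℕ → ℕ
redTerm X zero    ℓ n = 0
redTerm X (suc k) ℓ n = lag (suc k + ℓ) (X k ℓ) n

recurrence : Family → ℕ → ℕ → ℕ → ℕ
recurrence X k ℓ n = lag (k + ℓ) (X k ℓ) n + greenTerm X k ℓ n + redTerm X k ℓ n

record SatisfiesRecurrence (X : Family) : Set where
  field
    initial-zero : X 0 0 0 ≡ 1
    initial-suc  : ∀ n → X 0 0 (suc n) ≡ 0
    step         : ∀ k ℓ n → X k ℓ n ≡ recurrence X k ℓ n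

AgreeAt : Family → Family → ℕ → Set
AgreeAt X Y n = ∀ k ℓ → X k ℓ n ≡ Y k ℓ n

AgreeBelow : Family → Family → ℕ → Set
AgreeBelow X Y n = ∀ {j} → j < n → AgreeAt X Y j

greenTerm-cong : ∀ X Y k ℓ n → AgreeBelow X Y n → greenTerm X k ℓ n ≡ greenTerm Y k ℓ n
greenTerm-cong X Y k zero    n _   = refl
greenTerm-cong X Y k (suc ℓ) n X≈Y = lag-cong-< (2 * (k + suc ℓ)) n 1≤s (λ j j<n → X≈Y j<n k ℓ)
  where 1≤s = ≤-trans (s≤s z≤n) (≤-trans (m≤n+m (suc ℓ) k) (m≤m+n _ _))

redTerm-cong : ∀ X Y k ℓ n → AgreeBelow X Y n → redTerm X k ℓ n ≡ redTerm Y k ℓ n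
redTerm-cong X Y zero    ℓ n _   = refl
redTerm-cong X Y (suc k) ℓ n X≈Y = lag-cong-< (suc k + ℓ) n (s≤s z≤n) (λ j j<n → X≈Y j<n k ℓ)

recurrence-cong : ∀ X Y k ℓ n → 1 ≤ k + ℓ → AgreeBelow X Y n → recurrence X k ℓ n ≡ recurrence Y k ℓ n
recurrence-cong X Y k ℓ n 1≤k+ℓ X≈Y = cong₂ _+_
  (cong₂ _+_ (lag-cong-< (k + ℓ) n 1≤k+ℓ (λ j j<n → X≈Y j<n k ℓ)) (greenTerm-cong X Y k ℓ n X≈Y))
  (redTerm-cong X Y k ℓ n X≈Y)

recurrence-unique : ∀ {X Y} → SatisfiesRecurrence X → SatisfiesRecurrence Y → ∀ n → AgreeAt X Y n
recurrence-unique {X} {Y} recX recY = <-rec (AgreeAt X Y) agree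
  where
  module RX = SatisfiesRecurrence recX
  module RY = SatisfiesRecurrence recY
  by-step : ∀ {n} k ℓ → 1 ≤ k + ℓ → AgreeBelow X Y n → X k ℓ n ≡ Y k ℓ n
  by-step {n} k ℓ 1≤k+ℓ X≈Y = begin
    X k ℓ n            ≡⟨ RX.step k ℓ n ⟩
    recurrence X k ℓ n ≡⟨ recurrence-cong X Y k ℓ n 1≤k+ℓ X≈Y ⟩
    recurrence Y k ℓ n ≡⟨ RY.step k ℓ n ⟨
    Y k ℓ n            ∎
    where open ≡-Reasoning
  agree : ∀ n → AgreeBelow X Y n → AgreeAt X Y n
  agree zero    _   zero    zero    = trans RX.initial-zero (sym RY.initial-zero)
  agree (suc n) _   zero    zero    = trans (RX.initial-suc n) (sym (RY.initial-suc n))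
  agree n       X≈Y zero    (suc ℓ) = by-step zero (suc ℓ) (s≤s z≤n) X≈Y
  agree n       X≈Y (suc k) ℓ       = by-step (suc k) ℓ (s≤s z≤n) X≈Y

∈-colouredSubsets⁻ : ∀ {b ps} → ps ∈ colouredSubsets b → All (λ p → value p ≤ b) ps
∈-colouredSubsets⁻ {zero} (here refl) = []
∈-colouredSubsets⁻ {suc b} ps∈ with ∈-++⁻ (colouredSubsets b) ps∈
... | inj₁ ps∈′ = All.map m≤n⇒m≤1+n (∈-colouredSubsets⁻ ps∈′)
... | inj₂ ps∈″ with ∈-++⁻ (map ((suc b , red) ∷_) (colouredSubsets b)) ps∈″
...   | inj₁ ps∈ʳ with ∈-map⁻ _ ps∈ʳ
...     | qs , qs∈ , refl = ≤-refl ∷ All.map m≤n⇒m≤1+n (∈-colouredSubsets⁻ qs∈)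
∈-colouredSubsets⁻ {suc b} ps∈ | inj₂ _ | inj₂ ps∈ᵍ with ∈-map⁻ _ ps∈ᵍ
...     | qs , qs∈ , refl = ≤-refl ∷ All.map m≤n⇒m≤1+n (∈-colouredSubsets⁻ qs∈)

∈-colouredSubsets⁺ : ∀ {b ps} → Decreasing value ps → All (λ p → 1 ≤ value p) ps →
  All (λ p → value p ≤ b) ps → ps ∈ colouredSubsets b
∈-colouredSubsets⁺ {zero}  {[]}    _ _ _ = here refl
∈-colouredSubsets⁺ {zero}  {p ∷ _} _ (1≤p ∷ _) (p≤0 ∷ _) = contradiction p≤0 (<⇒≱ 1≤p)
∈-colouredSubsets⁺ {suc b} {[]}    _ _ _ = ∈-++⁺ˡ (∈-colouredSubsets⁺ {b} [] [] [])
∈-colouredSubsets⁺ {suc b} {(v , c) ∷ ps} dec (pos ∷ poss) (v≤1+b ∷ _) with v ≤? b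
... | yes v≤b = ∈-++⁺ˡ (∈-colouredSubsets⁺ dec (pos ∷ poss) (v≤b ∷ Decreasing-tail-≤ dec (m≤n⇒m≤1+n v≤b)))
... | no v≰b = top c (≤-antisym v≤1+b (≰⇒> v≰b))
  where
  tail∈ : ps ∈ colouredSubsets b
  tail∈ = ∈-colouredSubsets⁺ (Linked.tail dec) poss (Decreasing-tail-≤ dec v≤1+b)
  top : ∀ c → v ≡ suc b → ((v , c) ∷ ps) ∈ colouredSubsets (suc b)
  top red   refl = ∈-++⁺ʳ (colouredSubsets b) (∈-++⁺ˡ (∈-map⁺ _ tail∈))
  top green refl = ∈-++⁺ʳ (colouredSubsets b) (∈-++⁺ʳ (map ((suc b , red) ∷_) (colouredSubsets b)) (∈-map⁺ _ tail∈))

colouredSubsets-unique : ∀ b → Unique (colouredSubsets b)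
colouredSubsets-unique zero    = [] ∷ []
colouredSubsets-unique (suc b) = Unique-++⁺ uniq
  (Unique-++⁺ (Unique-map-injective⁺ ∷-injectiveʳ uniq) (Unique-map-injective⁺ ∷-injectiveʳ uniq) red-green-disjoint)
  old-new-disjoint
  where
  uniq = colouredSubsets-unique b
  top-not-old : ∀ {c ps} → ((suc b , c) ∷ ps) ∈ colouredSubsets b → ⊥
  top-not-old ps∈ with ∈-colouredSubsets⁻ ps∈
  ... | 1+b≤b ∷ _ = 1+n≰n 1+b≤b
  red-green-disjoint : Disjoint (map ((suc b , red) ∷_) (colouredSubsets b)) (map ((suc b , green) ∷_) (colouredSubsets b))
  red-green-disjoint (∈r , ∈g) with ∈-map⁻ _ ∈r | ∈-map⁻ _ ∈g
  ... | _ , _ , refl | _ , _ , ()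
  old-new-disjoint : Disjoint (colouredSubsets b)
    (map ((suc b , red) ∷_) (colouredSubsets b) ++ map ((suc b , green) ∷_) (colouredSubsets b))
  old-new-disjoint (∈old , ∈new) with ∈-++⁻ (map ((suc b , red) ∷_) (colouredSubsets b)) ∈new
  ... | inj₁ ∈r with ∈-map⁻ _ ∈r
  ...   | _ , _ , refl = top-not-old ∈old
  old-new-disjoint (∈old , ∈new) | inj₂ ∈g with ∈-map⁻ _ ∈g
  ...   | _ , _ , refl = top-not-old ∈old

∈-subsets⁻ : ∀ {b rs} → rs ∈ subsets b → All (_≤ b) rs
∈-subsets⁻ {zero} (here refl) = []
∈-subsets⁻ {suc b} rs∈ with ∈-++⁻ (subsets b) rs∈
... | inj₁ rs∈′ = All.map m≤n⇒m≤1+n (∈-subsets⁻ rs∈′)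
... | inj₂ rs∈″ with ∈-map⁻ _ rs∈″
...   | qs , qs∈ , refl = ≤-refl ∷ All.map m≤n⇒m≤1+n (∈-subsets⁻ qs∈)

∈-subsets⁺ : ∀ {b rs} → StrictDec rs → All (1 ≤_) rs → All (_≤ b) rs → rs ∈ subsets b
∈-subsets⁺ {zero}  {[]}    _ _ _ = here refl
∈-subsets⁺ {zero}  {r ∷ _} _ (1≤r ∷ _) (r≤0 ∷ _) = contradiction r≤0 (<⇒≱ 1≤r)
∈-subsets⁺ {suc b} {[]}    _ _ _ = ∈-++⁺ˡ (∈-subsets⁺ {b} [] [] [])
∈-subsets⁺ {suc b} {r ∷ rs} dec (pos ∷ poss) (r≤1+b ∷ _) with r ≤? b
... | yes r≤b = ∈-++⁺ˡ (∈-subsets⁺ dec (pos ∷ poss) (r≤b ∷ Decreasing-tail-≤ dec (m≤n⇒m≤1+n r≤b)))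
... | no r≰b = top (≤-antisym r≤1+b (≰⇒> r≰b))
  where
  top : r ≡ suc b → (r ∷ rs) ∈ subsets (suc b)
  top refl = ∈-++⁺ʳ (subsets b) (∈-map⁺ _ (∈-subsets⁺ (Linked.tail dec) poss (Decreasing-tail-≤ dec r≤1+b)))

subsets-unique : ∀ b → Unique (subsets b)
subsets-unique zero    = [] ∷ []
subsets-unique (suc b) = Unique-++⁺ uniq (Unique-map-injective⁺ ∷-injectiveʳ uniq) old-new-disjoint
  where
  uniq = subsets-unique b
  old-new-disjoint : Disjoint (subsets b) (map (suc b ∷_) (subsets b))
  old-new-disjoint (∈old , ∈new) with ∈-map⁻ _ ∈new
  ... | _ , _ , refl with ∈-subsets⁻ ∈old
  ...   | 1+b≤b ∷ _ = 1+n≰n 1+b≤b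

-- The partitions 𝓛₁

weight : List CPart → ℕ
weight ps = sum (map value ps)

Admissible : List CPart → Set
Admissible ps = All (PartOK 1) ps × Linked (Gap 1) ps

IsL? : ∀ n k ℓ → Decidable (IsL 1 n k ℓ)
IsL? = isL? 1

IsL-enumerated : ∀ n k ℓ → Enumerates (IsL 1 n k ℓ) (colouredSubsets n)
IsL-enumerated n k ℓ = colouredSubsets-unique n , complete
  where
  complete : ∀ {ps} → IsL 1 n k ℓ ps → ps ∈ colouredSubsets n
  complete {ps} (ok , gaps , refl , _) =
    ∈-colouredSubsets⁺ (Linked.map proj₁ gaps) (All.map proj₁ ok) (All-map⁻ (All-≤-sum (map value ps)))

lower raise : ℕ → CPart → CPart
lower s p = (value p ∸ s , color p)
raise s p = (s + value p , color p)

Above : ℕ → CPart → Set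
Above s p = s < value p × p ≢ (suc s , green)

lower-PartOK : ∀ {s p} → Above s p → PartOK 1 (lower s p)
lower-PartOK {s} {v , c} (s<v , p≢1+s) =
  positive , (λ eq → p≢1+s (cong₂ _,_ (value≡ (cong proj₁ eq)) (cong proj₂ eq))) , (λ eq → <⇒≢ positive (sym (cong proj₁ eq)))
  where
  positive : 1 ≤ v ∸ s
  positive = m<n⇒0<n∸m s<v
  value≡ : v ∸ s ≡ 1 → v ≡ suc s
  value≡ eq = trans (sym (m+[n∸m]≡n (<⇒≤ s<v))) (trans (cong (s +_) eq) (+-comm s 1))

raise-PartOK : ∀ {s p} → 1 ≤ s → PartOK 1 p → PartOK 1 (raise s p)
raise-PartOK {s} {v , c} 1≤s (1≤v , _ , _) =
  ≤-trans 1≤s (m≤m+n s v) ,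
  (λ eq → <⇒≢ 2≤s+v (sym (cong proj₁ eq))) , (λ eq → <⇒≢ (<-trans z<s 2≤s+v) (sym (cong proj₁ eq)))
  where
  2≤s+v : 2 ≤ s + v
  2≤s+v = +-mono-≤ 1≤s 1≤v

∸-gap : ∀ {a b s} d → s ≤ b → b + d ≤ a → b ∸ s + d ≤ a ∸ s
∸-gap {a} {s = s} d s≤b gap = subst (_≤ a ∸ s) (+-∸-comm d s≤b) (∸-monoˡ-≤ s gap)

+-gap : ∀ {a b} s d → b + d ≤ a → s + b + d ≤ s + a
+-gap {a} s d gap = subst (_≤ s + a) (sym (+-assoc s _ d)) (+-monoʳ-≤ s gap)

lower-Gap : ∀ {s p q} → s ≤ value q → Gap 1 p q → Gap 1 (lower s p) (lower s q)
lower-Gap {p = a , red}   s≤b (b<a , gap) = ∸-monoˡ-< b<a s≤b , ∸-gap 1 s≤b gap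
lower-Gap {p = a , green} s≤b (b<a , gap) = ∸-monoˡ-< b<a s≤b , ∸-gap 2 s≤b gap

raise-Gap : ∀ {s p q} → Gap 1 p q → Gap 1 (raise s p) (raise s q)
raise-Gap {s} {a , red}   (b<a , gap) = +-monoʳ-< s b<a , +-gap s 1 gap
raise-Gap {s} {a , green} (b<a , gap) = +-monoʳ-< s b<a , +-gap s 2 gap

lower-Admissible : ∀ {s ps} → All (Above s) ps → Linked (Gap 1) ps → Admissible (map (lower s) ps)
lower-Admissible {s} above gaps =
  All-map⁺ (All.map lower-PartOK above) ,
  Linked-map⁺ (lower s) (λ {p} {q} _ (s<q , _) → lower-Gap {s} {p} {q} (<⇒≤ s<q)) above gaps

raise-Admissible : ∀ {s qs} → 1 ≤ s → Admissible qs → Admissible (map (raise s) qs)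
raise-Admissible {s} 1≤s (ok , gaps) =
  All-map⁺ (All.map (raise-PartOK 1≤s) ok) , Linked-map⁺ (raise s) (λ {p} {q} _ _ → raise-Gap {s} {p} {q}) ok gaps

raise-lower : ∀ {s ps} → All (λ p → s ≤ value p) ps → map (raise s) (map (lower s) ps) ≡ ps
raise-lower {s} {ps} s≤ps =
  trans (sym (map-∘ ps)) (map-id-local (All.map (λ s≤p → cong (_, _) (m+[n∸m]≡n s≤p)) s≤ps))

lower-raise : ∀ s qs → map (lower s) (map (raise s) qs) ≡ qs
lower-raise s qs =
  trans (sym (map-∘ qs)) (map-id-local (All.universal (λ q → cong (_, color q) (m+n∸m≡n s (value q))) qs))

weight-raise : ∀ s qs → weight (map (raise s) qs) ≡ s * length qs + weight qs
weight-raise s qs = begin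
  weight (map (raise s) qs)                        ≡⟨ cong sum (map-∘ {g = value} {f = raise s} qs) ⟨
  sum (map (λ q → s + value q) qs)                 ≡⟨ cong sum (map-∘ {g = s +_} {f = value} qs) ⟩
  sum (map (s +_) (map value qs))                  ≡⟨ sum-map-+ s (map value qs) ⟩
  s * length (map value qs) + weight qs            ≡⟨ cong (λ m → s * m + weight qs) (length-map value qs) ⟩
  s * length qs + weight qs                        ∎
  where open ≡-Reasoning

weight-lower : ∀ {s ps} → All (λ p → s ≤ value p) ps → weight ps ≡ s * length ps + weight (map (lower s) ps)
weight-lower {s} {ps} s≤ps = begin
  weight ps                                           ≡⟨ cong weight (raise-lower s≤ps) ⟨
  weight (map (raise s) (map (lower s) ps))            ≡⟨ weight-raise s (map (lower s) ps) ⟩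
  s * length (map (lower s) ps) + weight (map (lower s) ps)
    ≡⟨ cong (λ m → s * m + weight (map (lower s) ps)) (length-map (lower s) ps) ⟩
  s * length ps + weight (map (lower s) ps)           ∎
  where open ≡-Reasoning

weight-∷ʳ-lower : ∀ ys x → All (λ p → value x ≤ value p) ys →
  weight (ys ∷ʳ x) ≡ value x * length (ys ∷ʳ x) + weight (map (lower (value x)) ys)
weight-∷ʳ-lower ys x s≤ys = begin
  weight (ys ∷ʳ x)                        ≡⟨ cong sum (map-++ value ys (x ∷ [])) ⟩
  sum (map value ys ++ (s ∷ []))          ≡⟨ sum-++ (map value ys) (s ∷ []) ⟩
  weight ys + (s + 0)                     ≡⟨ cong (_+ (s + 0)) (weight-lower s≤ys) ⟩
  s * length ys + w + (s + 0)             ≡⟨ rearrange s (length ys) w ⟩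
  s * (length ys + 1) + w                 ≡⟨ cong (λ m → s * m + w) (length-++ ys) ⟨
  s * length (ys ∷ʳ x) + w                ∎
  where
  open ≡-Reasoning
  s = value x
  w = weight (map (lower s) ys)
  rearrange : ∀ s m w → s * m + w + (s + 0) ≡ s * (m + 1) + w
  rearrange = solve-∀

length≡numRed+numGreen : ∀ ps → length ps ≡ numRed ps + numGreen ps
length≡numRed+numGreen []                = refl
length≡numRed+numGreen ((_ , red)   ∷ ps) = cong suc (length≡numRed+numGreen ps)
length≡numRed+numGreen ((_ , green) ∷ ps) = trans (cong suc (length≡numRed+numGreen ps)) (sym (+-suc _ _))

numColour : Color → List CPart → ℕ
numColour c = count (λ p → color p ≟ᶜ c)

numColour-∈ : ∀ {x} ps → x ∈ ps → 1 ≤ numColour (color x) ps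
numColour-∈ {x} (p ∷ ps) x∈ with color p ≟ᶜ color x
... | yes _ = s≤s z≤n
numColour-∈     (p ∷ ps) (here refl) | no c≢c = contradiction refl c≢c
numColour-∈     (p ∷ ps) (there x∈)  | no _   = numColour-∈ ps x∈

numColour-init : ∀ c ys x {k} → numColour c (ys ∷ʳ x) ≡ numColour c (x ∷ []) + k → numColour c ys ≡ k
numColour-init c ys x {k} eq =
  +-cancelʳ-≡ (numColour c (x ∷ [])) _ _ (trans (sym (count-++ _ ys (x ∷ []))) (trans eq (+-comm _ k)))

numColour-∷ʳ : ∀ c ys x {k} → numColour c ys ≡ k → numColour c (ys ∷ʳ x) ≡ numColour c (x ∷ []) + k
numColour-∷ʳ c ys x {k} eq = trans (count-++ _ ys (x ∷ [])) (trans (cong (_+ _) eq) (+-comm k _))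

numColour-lower : ∀ c s ps → numColour c (map (lower s) ps) ≡ numColour c ps
numColour-lower c s = count-map _ (lower s)

numColour-raise : ∀ c s ps → numColour c (map (raise s) ps) ≡ numColour c ps
numColour-raise c s = count-map _ (raise s)

Above-+2 : ∀ {s p} → suc (suc s) ≤ value p → Above s p
Above-+2 2+s≤p = <-trans (n<1+n _) 2+s≤p , λ eq → <⇒≢ 2+s≤p (sym (cong proj₁ eq))

Above-before-last : ∀ ys {x} → Linked (Gap 1) (ys ∷ʳ x) → All (Above (value x)) ys
Above-before-last []                  _                          = []
Above-before-last ((a , red)   ∷ [])  ((x<a , _) ∷ _)            = (x<a , λ ()) ∷ []
Above-before-last ((a , green) ∷ []) {x} ((_ , x+2≤a) ∷ _)       = Above-+2 (subst (_≤ a) (+-comm (value x) 2) x+2≤a) ∷ []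
Above-before-last (y ∷ z ∷ ys) ((z<y , _) ∷ gaps) with Above-before-last (z ∷ ys) gaps
... | above@((x<z , _) ∷ _) = Above-+2 (≤-trans (s≤s x<z) z<y) ∷ above

Above-if-ordinary : ∀ ps → Admissible ps → ¬ EndsWith (1 , red) ps → ¬ EndsWith (2 , green) ps → All (Above 1) ps
Above-if-ordinary []                              _                  _      _      = []
Above-if-ordinary ((zero , _) ∷ [])              ((() , _) ∷ _ , _) _      _
Above-if-ordinary ((suc zero , red)   ∷ [])       _                  not1ᵣ  _      = contradiction refl not1ᵣ
Above-if-ordinary ((suc zero , green) ∷ [])       ((_ , not1g , _) ∷ _ , _) _ _    = contradiction refl not1g
Above-if-ordinary ((suc (suc zero) , red) ∷ [])   _                  _      _      = (s≤s (s≤s z≤n) , λ ()) ∷ []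
Above-if-ordinary ((suc (suc zero) , green) ∷ []) _                  _      not2g  = contradiction refl not2g
Above-if-ordinary ((suc (suc (suc _)) , _) ∷ [])  _                  _      _      = Above-+2 (s≤s (s≤s (s≤s z≤n))) ∷ []
Above-if-ordinary (p ∷ q ∷ ps) (_ ∷ ok , (q<p , _) ∷ gaps) not1ᵣ not2g
  with Above-if-ordinary (q ∷ ps) (ok , gaps) not1ᵣ not2g
... | above@((1<q , _) ∷ _) = Above-+2 (≤-trans (s≤s 1<q) q<p) ∷ above

L-lowering-ordinary : ∀ n k ℓ →
  Lowering ((IsL 1 n k ℓ ∩ ∁ (EndsWith (1 , red))) ∩ ∁ (EndsWith (2 , green))) (λ j → IsL 1 j k ℓ) (k + ℓ) n
L-lowering-ordinary n k ℓ = record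
  { to        = map (lower 1)
  ; from      = map (raise 1)
  ; to-maps   = λ {ps} (((ok , gaps , w≡n , #r , #g) , not1ᵣ) , not2g) →
      let above = Above-if-ordinary ps (ok , gaps) not1ᵣ not2g
          (ok′ , gaps′) = lower-Admissible above gaps
      in _ , weight-shift ps (trans (length≡numRed+numGreen ps) (cong₂ _+_ #r #g)) (All.map (<⇒≤ ∘ proj₁) above) w≡n ,
         ok′ , gaps′ , refl , trans (numColour-lower red 1 ps) #r , trans (numColour-lower green 1 ps) #g
  ; from-maps = λ {j} {qs} n≡ (ok , gaps , w≡j , #r , #g) →
      let (ok′ , gaps′) = raise-Admissible (s≤s z≤n) (ok , gaps)
      in ((ok′ , gaps′ , weight-raised qs (trans (length≡numRed+numGreen qs) (cong₂ _+_ #r #g)) w≡j n≡ ,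
           trans (numColour-raise red 1 qs) #r , trans (numColour-raise green 1 qs) #g) ,
          not-end-1ᵣ qs ok) , not-end-2g qs ok
  ; from∘to   = λ {ps} (((ok , gaps , _) , not1ᵣ) , not2g) →
      raise-lower (All.map (<⇒≤ ∘ proj₁) (Above-if-ordinary ps (ok , gaps) not1ᵣ not2g))
  ; to∘from   = λ {_} {qs} _ _ → lower-raise 1 qs
  }
  where
  weight-shift : ∀ ps → length ps ≡ k + ℓ → All (λ p → 1 ≤ value p) ps → weight ps ≡ n →
    n ≡ k + ℓ + weight (map (lower 1) ps)
  weight-shift ps len 1≤ps w≡n =
    trans (sym w≡n) (trans (weight-lower 1≤ps) (cong (_+ weight (map (lower 1) ps)) (trans (*-identityˡ _) len)))
  weight-raised : ∀ {j} qs → length qs ≡ k + ℓ → weight qs ≡ j → n ≡ k + ℓ + j → weight (map (raise 1) qs) ≡ n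
  weight-raised qs len w≡j n≡ =
    trans (weight-raise 1 qs) (trans (cong₂ _+_ (trans (*-identityˡ _) len) w≡j) (sym n≡))
  not-end-1ᵣ : ∀ qs → All (PartOK 1) qs → ¬ EndsWith (1 , red) (map (raise 1) qs)
  not-end-1ᵣ qs ok ends with last-map⁻ (raise 1) qs ends
  ... | q , q-last , refl with All.lookup ok (last-∈ qs q-last)
  ...   | () , _
  not-end-2g : ∀ qs → All (PartOK 1) qs → ¬ EndsWith (2 , green) (map (raise 1) qs)
  not-end-2g qs ok ends with last-map⁻ (raise 1) qs ends
  ... | (suc zero , green) , q-last , refl with All.lookup ok (last-∈ qs q-last)
  ...   | _ , not1g , _ = not1g refl

PartOK-green-≥2 : ∀ {v} → PartOK 1 (v , green) → 2 ≤ v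
PartOK-green-≥2 {suc zero}    (_ , not1g , _) = contradiction refl not1g
PartOK-green-≥2 {suc (suc _)} _               = s≤s (s≤s z≤n)

Gap-raised-last : ∀ x {qs} → All (PartOK 1) qs → ∀ {y} → last (map (raise (value x)) qs) ≡ just y → Gap 1 y x
Gap-raised-last x {qs} ok ends with last-map⁻ (raise (value x)) qs ends
... | (v , c) , q-last , refl = subst (_≤ s + v) (+-comm s 1) (+-monoʳ-≤ s 1≤v) , gap c (All.lookup ok (last-∈ qs q-last))
  where
  s = value x
  1≤v = proj₁ (All.lookup ok (last-∈ qs q-last))
  gap : ∀ c → PartOK 1 (v , c) → GapC 1 c (s + v) s
  gap red   _  = +-monoʳ-≤ s 1≤v
  gap green ok = +-monoʳ-≤ s (PartOK-green-≥2 ok)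

module LastPart (x : CPart) (k ℓ : ℕ) where

  private
    s = value x

  k⁺ ℓ⁺ : ℕ
  k⁺ = numRed (x ∷ []) + k
  ℓ⁺ = numGreen (x ∷ []) + ℓ

  length≡ : ∀ ps → numRed ps ≡ k⁺ → numGreen ps ≡ ℓ⁺ → length ps ≡ k⁺ + ℓ⁺
  length≡ ps #r #g = trans (length≡numRed+numGreen ps) (cong₂ _+_ #r #g)

  s≤before-last : ∀ ys → Linked (Gap 1) (ys ∷ʳ x) → All (λ p → s ≤ value p) ys
  s≤before-last ys gaps = All.map (<⇒≤ ∘ proj₁) (Above-before-last ys gaps)

  lower-before-last : ∀ {n} ys → IsL 1 n k⁺ ℓ⁺ (ys ∷ʳ x) →
    n ≡ s * (k⁺ + ℓ⁺) + weight (map (lower s) ys) × IsL 1 (weight (map (lower s) ys)) k ℓ (map (lower s) ys)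
  lower-before-last {n} ys (ok , gaps , w≡n , #r , #g) =
    (begin
      n                                                ≡⟨ w≡n ⟨
      weight (ys ∷ʳ x)                                 ≡⟨ weight-∷ʳ-lower ys x (s≤before-last ys gaps) ⟩
      s * length (ys ∷ʳ x) + weight (map (lower s) ys)
        ≡⟨ cong (λ m → s * m + weight (map (lower s) ys)) (length≡ (ys ∷ʳ x) #r #g) ⟩
      s * (k⁺ + ℓ⁺) + weight (map (lower s) ys)        ∎) ,
    ok′ , gaps′ , refl ,
    trans (numColour-lower red s ys) (numColour-init red ys x #r) ,
    trans (numColour-lower green s ys) (numColour-init green ys x #g)
    where
    open ≡-Reasoning
    adm = lower-Admissible (Above-before-last ys gaps) (Linked-∷ʳ⁻ ys gaps)
    ok′ = proj₁ adm
    gaps′ = proj₂ adm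

  raise-and-append : ∀ {n j} qs → PartOK 1 x → n ≡ s * (k⁺ + ℓ⁺) + j → IsL 1 j k ℓ qs → IsL 1 n k⁺ ℓ⁺ (map (raise s) qs ∷ʳ x)
  raise-and-append {n} {j} qs x-ok@(1≤s , _) n≡ (ok , gaps , w≡j , #r , #g) =
    All-∷ʳ⁺ (proj₁ adm) x-ok , Linked-∷ʳ⁺ (proj₂ adm) (Gap-raised-last x ok) ,
    (begin
      weight (map (raise s) qs ∷ʳ x)                       ≡⟨ weight-∷ʳ-lower (map (raise s) qs) x s≤raised ⟩
      s * length (map (raise s) qs ∷ʳ x) + weight (map (lower s) (map (raise s) qs))
        ≡⟨ cong₂ (λ m w → s * m + w) (length≡ (map (raise s) qs ∷ʳ x) #r′ #g′) (cong weight (lower-raise s qs)) ⟩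
      s * (k⁺ + ℓ⁺) + weight qs                            ≡⟨ cong (s * (k⁺ + ℓ⁺) +_) w≡j ⟩
      s * (k⁺ + ℓ⁺) + j                                    ≡⟨ n≡ ⟨
      n                                                    ∎) ,
    #r′ , #g′
    where
    open ≡-Reasoning
    adm = raise-Admissible 1≤s (ok , gaps)
    s≤raised : All (λ p → s ≤ value p) (map (raise s) qs)
    s≤raised = All-map⁺ (All.universal (λ q → m≤m+n s (value q)) qs)
    #r′ = numColour-∷ʳ red (map (raise s) qs) x (trans (numColour-raise red s qs) #r)
    #g′ = numColour-∷ʳ green (map (raise s) qs) x (trans (numColour-raise green s qs) #g)

L-lowering-last : ∀ x n k ℓ → PartOK 1 x →
  let open LastPart x k ℓ in Lowering (IsL 1 n k⁺ ℓ⁺ ∩ EndsWith x) (λ j → IsL 1 j k ℓ) (value x * (k⁺ + ℓ⁺)) n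
L-lowering-last x n k ℓ x-ok = record
  { to        = λ ps → map (lower s) (init ps)
  ; from      = λ qs → map (raise s) qs ∷ʳ x
  ; to-maps   = λ {ps} (isL , ends) → _ , lower-before-last (init ps) (subst (IsL 1 n _ _) (sym (init-∷ʳ-last ps ends)) isL)
  ; from-maps = λ {_} {qs} n≡ isL → raise-and-append qs x-ok n≡ isL , last-∷ʳ (map (raise s) qs)
  ; from∘to   = λ {ps} ((_ , gaps , _) , ends) → begin
      map (raise s) (map (lower s) (init ps)) ∷ʳ x ≡⟨ cong (_∷ʳ x) (raise-lower (s≤init ps ends gaps)) ⟩
      init ps ∷ʳ x                                 ≡⟨ init-∷ʳ-last ps ends ⟩
      ps                                           ∎
  ; to∘from   = λ {_} {qs} _ _ → trans (cong (map (lower s)) (init-∷ʳ (map (raise s) qs))) (lower-raise s qs)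
  }
  where
  open LastPart x k ℓ
  open ≡-Reasoning
  s = value x
  s≤init : ∀ ps → EndsWith x ps → Linked (Gap 1) ps → All (λ p → s ≤ value p) (init ps)
  s≤init ps ends gaps = s≤before-last (init ps) (subst (Linked (Gap 1)) (sym (init-∷ʳ-last ps ends)) gaps)

ends-1ᵣ? : Decidable (EndsWith (1 , red))
ends-1ᵣ? = endsWith? _≟ᵖ_ (1 , red)

ends-2g? : Decidable (EndsWith (2 , green))
ends-2g? = endsWith? _≟ᵖ_ (2 , green)

𝓛 : Family
𝓛 k ℓ n = L 1 n k ℓ

L-empty : ∀ n ps → IsL 1 n 0 0 ps → n ≡ 0
L-empty n []      (_ , _ , w≡n , _)    = sym w≡n
L-empty n (p ∷ ps) (_ , _ , _ , #r , #g) with trans (length≡numRed+numGreen (p ∷ ps)) (cong₂ _+_ #r #g)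
... | ()

count-lowering-𝓛 : ∀ {n k ℓ k′ ℓ′ s} {P : Pred (List CPart) 0ℓ} (P? : Decidable P) → P ⊆ᵖ IsL 1 n k ℓ →
  Lowering P (λ j → IsL 1 j k′ ℓ′) s n → count P? (colouredSubsets n) ≡ lag s (𝓛 k′ ℓ′) n
count-lowering-𝓛 {n} {k} {ℓ} {k′} {ℓ′} P? P⊆IsL =
  count-lowering P? (λ j → IsL? j k′ ℓ′) (colouredSubsets-unique n , proj₂ (IsL-enumerated n k ℓ) ∘ P⊆IsL)
    (λ j → IsL-enumerated j k′ ℓ′)

L-count-ordinary : ∀ k ℓ n → count ((IsL? n k ℓ ∩? ∁? ends-1ᵣ?) ∩? ∁? ends-2g?) (colouredSubsets n) ≡ lag (k + ℓ) (𝓛 k ℓ) n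
L-count-ordinary k ℓ n = count-lowering-𝓛 {n = n} _ (proj₁ ∘ proj₁) (L-lowering-ordinary n k ℓ)

L-count-1ᵣ : ∀ k ℓ n → count (IsL? n k ℓ ∩? ends-1ᵣ?) (colouredSubsets n) ≡ redTerm 𝓛 k ℓ n
L-count-1ᵣ zero    ℓ n = count-none _ (colouredSubsets n)
  λ ps ((_ , _ , _ , #r , _) , ends) → <⇒≱ (subst (1 ≤_) #r (numColour-∈ ps (last-∈ ps ends))) ≤-refl
L-count-1ᵣ (suc k) ℓ n =
  trans (count-lowering-𝓛 {n = n} _ proj₁ (L-lowering-last (1 , red) n k ℓ (s≤s z≤n , (λ ()) , (λ ()))))
        (cong (λ t → lag t (𝓛 k ℓ) n) (*-identityˡ (suc k + ℓ)))

L-count-2g : ∀ k ℓ n → count ((IsL? n k ℓ ∩? ∁? ends-1ᵣ?) ∩? ends-2g?) (colouredSubsets n) ≡ greenTerm 𝓛 k ℓ n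
L-count-2g k zero    n = count-none _ (colouredSubsets n)
  λ ps (((_ , _ , _ , _ , #g) , _) , ends) → <⇒≱ (subst (1 ≤_) #g (numColour-∈ ps (last-∈ ps ends))) ≤-refl
L-count-2g k (suc ℓ) n = count-lowering-𝓛 {n = n} _ (proj₁ ∘ proj₁)
  (Lowering-⇔ (λ ((isL , _) , ends) → isL , ends) (λ {ps} (isL , ends) → (isL , not-1ᵣ ps ends) , ends) id id
    (L-lowering-last (2 , green) n k ℓ (s≤s z≤n , (λ ()) , (λ ()))))
  where
  not-1ᵣ : ∀ ps → EndsWith (2 , green) ps → ¬ EndsWith (1 , red) ps
  not-1ᵣ ps ends₂ ends₁ with trans (sym ends₁) ends₂
  ... | ()

L-recurrence : SatisfiesRecurrence 𝓛
L-recurrence = record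
  { initial-zero = refl
  ; initial-suc  = λ n → count-none _ (colouredSubsets (suc n)) (λ ps isL → 1+n≢0 (L-empty (suc n) ps isL))
  ; step         = step
  }
  where
  step : ∀ k ℓ n → 𝓛 k ℓ n ≡ recurrence 𝓛 k ℓ n
  step k ℓ n = begin
    count isL ps
      ≡⟨ count-split isL ends-1ᵣ? ps ⟩
    count (isL ∩? ends-1ᵣ?) ps + count (isL ∩? ∁? ends-1ᵣ?) ps
      ≡⟨ cong (count (isL ∩? ends-1ᵣ?) ps +_) (count-split (isL ∩? ∁? ends-1ᵣ?) ends-2g? ps) ⟩
    count (isL ∩? ends-1ᵣ?) ps + (count ((isL ∩? ∁? ends-1ᵣ?) ∩? ends-2g?) ps + count ((isL ∩? ∁? ends-1ᵣ?) ∩? ∁? ends-2g?) ps)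
      ≡⟨ cong₂ _+_ (L-count-1ᵣ k ℓ n) (cong₂ _+_ (L-count-2g k ℓ n) (L-count-ordinary k ℓ n)) ⟩
    redTerm 𝓛 k ℓ n + (greenTerm 𝓛 k ℓ n + lag (k + ℓ) (𝓛 k ℓ) n)
      ≡⟨ reverse-sum (redTerm 𝓛 k ℓ n) (greenTerm 𝓛 k ℓ n) (lag (k + ℓ) (𝓛 k ℓ) n) ⟩
    recurrence 𝓛 k ℓ n ∎
    where
    open ≡-Reasoning
    isL = IsL? n k ℓ
    ps = colouredSubsets n
    reverse-sum : ∀ a b c → a + (b + c) ≡ c + b + a
    reverse-sum = solve-∀

-- The pairs counted by A

countAbove : ℕ → List ℕ → ℕ
countAbove t = count (t <?_)

DistinctParts : List ℕ → Set
DistinctParts rs = All (1 ≤_) rs × StrictDec rs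

lowerAbove raiseAbove : ℕ → ℕ → ℕ
lowerAbove t r with t <? r
... | yes _ = pred r
... | no _  = r
raiseAbove t r with t <? r
... | yes _ = suc r
... | no _  = r

module _ {t : ℕ} where

  private
    above-next : ∀ {r} → t < r → suc t ≢ r → suc t < r
    above-next t<r 1+t≢r = ≤∧≢⇒< t<r 1+t≢r

  lowerAbove-mono-< : ∀ {a b} → suc t ≢ a → b < a → lowerAbove t b < lowerAbove t a
  lowerAbove-mono-< {a} {b} 1+t≢a b<a with t <? a | t <? b
  ... | yes t<a | yes t<b = pred-mono-< {{>-nonZero (≤-trans (s≤s z≤n) t<b)}} b<a
  ... | yes t<a | no  t≮b = ≤-trans (s≤s (≮⇒≥ t≮b)) (suc[m]≤n⇒m≤pred[n] (above-next t<a 1+t≢a))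
  ... | no  t≮a | yes t<b = contradiction (<-trans t<b b<a) t≮a
  ... | no  _   | no  _   = b<a

  raiseAbove-mono-< : ∀ {a b} → b < a → raiseAbove t b < raiseAbove t a
  raiseAbove-mono-< {a} {b} b<a with t <? a | t <? b
  ... | yes _   | yes _   = s≤s b<a
  ... | yes _   | no  _   = m<n⇒m<1+n b<a
  ... | no  t≮a | yes t<b = contradiction (<-trans t<b b<a) t≮a
  ... | no  _   | no  _   = b<a

  lowerAbove-positive : ∀ {r} → 1 ≤ r → suc t ≢ r → 1 ≤ lowerAbove t r
  lowerAbove-positive {r} 1≤r 1+t≢r with t <? r
  ... | yes t<r = suc[m]≤n⇒m≤pred[n] (≤-trans (s≤s (s≤s z≤n)) (above-next t<r 1+t≢r))
  ... | no  _   = 1≤r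

  raiseAbove-positive : ∀ {r} → 1 ≤ r → 1 ≤ raiseAbove t r
  raiseAbove-positive {r} 1≤r with t <? r
  ... | yes _ = s≤s z≤n
  ... | no  _ = 1≤r

  raiseAbove-lowerAbove : ∀ {r} → suc t ≢ r → raiseAbove t (lowerAbove t r) ≡ r
  raiseAbove-lowerAbove {r} 1+t≢r with t <? r
  raiseAbove-lowerAbove {suc r} 1+t≢r | yes t<r with t <? r
  ... | yes _  = refl
  ... | no t≮r = contradiction (≤-pred (above-next t<r 1+t≢r)) t≮r
  raiseAbove-lowerAbove {r} _ | no t≮r with t <? r
  ... | yes t<r = contradiction t<r t≮r
  ... | no  _   = refl

  lowerAbove-raiseAbove : ∀ r → lowerAbove t (raiseAbove t r) ≡ r
  lowerAbove-raiseAbove r with t <? r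
  ... | yes t<r with t <? suc r
  ...   | yes _    = refl
  ...   | no t≮1+r = contradiction (m<n⇒m<1+n t<r) t≮1+r
  lowerAbove-raiseAbove r | no t≮r with t <? r
  ...   | yes t<r = contradiction t<r t≮r
  ...   | no  _   = refl

  raiseAbove-≢ : ∀ r → suc t ≢ raiseAbove t r
  raiseAbove-≢ r with t <? r
  ... | yes t<r = λ eq → <-irrefl (suc-injective eq) t<r
  ... | no  t≮r = λ eq → t≮r (≤-reflexive eq)

  lowerAbove-above : ∀ {r} → suc t ≢ r → (t < lowerAbove t r → t < r) × (t < r → t < lowerAbove t r)
  lowerAbove-above {r} 1+t≢r with t <? r
  ... | yes t<r = (λ _ → t<r) , (λ _ → suc[m]≤n⇒m≤pred[n] (above-next t<r 1+t≢r))
  ... | no  _   = (λ t<r → t<r) , (λ t<r → t<r)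

  raiseAbove-above : ∀ r → (t < raiseAbove t r → t < r) × (t < r → t < raiseAbove t r)
  raiseAbove-above r with t <? r
  ... | yes t<r = (λ _ → t<r) , m<n⇒m<1+n
  ... | no  _   = (λ t<r → t<r) , (λ t<r → t<r)

sum-lowerAbove : ∀ t rs → sum rs ≡ countAbove t rs + sum (map (lowerAbove t) rs)
sum-lowerAbove t []       = refl
sum-lowerAbove t (r ∷ rs) with t <? r
... | yes t<r rewrite count-accept (t <?_) rs t<r = begin
  r + sum rs
    ≡⟨ cong₂ _+_ (sym (suc-pred r {{>-nonZero (≤-trans (s≤s z≤n) t<r)}})) (sum-lowerAbove t rs) ⟩
  suc (pred r) + (c + sum (map (lowerAbove t) rs)) ≡⟨ cong suc (x∙yz≈y∙xz (pred r) c _) ⟩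
  suc c + (pred r + sum (map (lowerAbove t) rs)) ∎
  where
  open ≡-Reasoning
  c = countAbove t rs
... | no t≮r rewrite count-reject (t <?_) rs t≮r =
  trans (cong (r +_) (sum-lowerAbove t rs)) (x∙yz≈y∙xz r (countAbove t rs) _)

countAbove-lowerAbove : ∀ t {rs} → suc t ∉ rs → countAbove t (map (lowerAbove t) rs) ≡ countAbove t rs
countAbove-lowerAbove t {rs} 1+t∉rs =
  trans (count-map (t <?_) (lowerAbove t) rs) (count-cong-local _ _ (All.map lowerAbove-above (¬Any⇒All¬ rs 1+t∉rs)))

countAbove-raiseAbove : ∀ t rs → countAbove t (map (raiseAbove t) rs) ≡ countAbove t rs
countAbove-raiseAbove t rs =
  trans (count-map (t <?_) (raiseAbove t) rs) (count-cong-local _ _ (All.universal raiseAbove-above rs))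

raiseAbove-lowerAbove-list : ∀ t {rs} → suc t ∉ rs → map (raiseAbove t) (map (lowerAbove t) rs) ≡ rs
raiseAbove-lowerAbove-list t {rs} 1+t∉rs =
  trans (sym (map-∘ rs)) (map-id-local (All.map raiseAbove-lowerAbove (¬Any⇒All¬ rs 1+t∉rs)))

lowerAbove-raiseAbove-list : ∀ t rs → map (lowerAbove t) (map (raiseAbove t) rs) ≡ rs
lowerAbove-raiseAbove-list t rs = trans (sym (map-∘ rs)) (map-id-local (All.universal lowerAbove-raiseAbove rs))

sum-raiseAbove : ∀ t rs → sum (map (raiseAbove t) rs) ≡ countAbove t rs + sum rs
sum-raiseAbove t rs = begin
  sum (map (raiseAbove t) rs)
    ≡⟨ sum-lowerAbove t (map (raiseAbove t) rs) ⟩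
  countAbove t (map (raiseAbove t) rs) + sum (map (lowerAbove t) (map (raiseAbove t) rs))
    ≡⟨ cong₂ _+_ (countAbove-raiseAbove t rs) (cong sum (lowerAbove-raiseAbove-list t rs)) ⟩
  countAbove t rs + sum rs                                                     ∎
  where open ≡-Reasoning

suc-∉-raiseAbove : ∀ t rs → suc t ∉ map (raiseAbove t) rs
suc-∉-raiseAbove t rs 1+t∈ with ∈-map⁻ (raiseAbove t) 1+t∈
... | r , _ , eq = raiseAbove-≢ r eq

lowerAbove-Distinct : ∀ t {rs} → DistinctParts rs → suc t ∉ rs → DistinctParts (map (lowerAbove t) rs)
lowerAbove-Distinct t {rs} (pos , dec) 1+t∉rs =
  All-map⁺ (All.zipWith (λ (1≤r , ≢r) → lowerAbove-positive 1≤r ≢r) (pos , ne)) ,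
  Linked-map⁺ (lowerAbove t) (λ ≢a _ b<a → lowerAbove-mono-< ≢a b<a) ne dec
  where ne = ¬Any⇒All¬ rs 1+t∉rs

raiseAbove-Distinct : ∀ t {rs} → DistinctParts rs → DistinctParts (map (raiseAbove t) rs)
raiseAbove-Distinct t (pos , dec) =
  All-map⁺ (All.map raiseAbove-positive pos) , Linked-map⁺ (raiseAbove t) (λ _ _ → raiseAbove-mono-<) pos dec

delete : ℕ → List ℕ → List ℕ
delete x []       = []
delete x (r ∷ rs) with r ≟ x
... | yes _ = rs
... | no  _ = r ∷ delete x rs

insert : ℕ → List ℕ → List ℕ
insert x []       = x ∷ []
insert x (r ∷ rs) with x <? r
... | yes _ = r ∷ insert x rs
... | no  _ = x ∷ r ∷ rs

delete-↭ : ∀ {x} rs → x ∈ rs → x ∷ delete x rs ↭ rs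
delete-↭ {x} (r ∷ rs) x∈ with r ≟ x
... | yes refl = ↭.refl
delete-↭ (r ∷ rs) (here x≡r)  | no r≢x = contradiction (sym x≡r) r≢x
delete-↭ (r ∷ rs) (there x∈) | no _   = ↭.trans (swap _ r ↭.refl) (prep r (delete-↭ rs x∈))

insert-↭ : ∀ x rs → insert x rs ↭ x ∷ rs
insert-↭ x []       = ↭.refl
insert-↭ x (r ∷ rs) with x <? r
... | yes _ = ↭.trans (prep r (insert-↭ x rs)) (swap r x ↭.refl)
... | no  _ = ↭.refl

delete-∉ : ∀ x {rs} → StrictDec rs → x ∉ delete x rs
delete-∉ x {r ∷ rs} dec x∈ with r ≟ x
delete-∉ x {r ∷ rs} dec x∈          | yes refl = <-irrefl refl (All.lookup (Decreasing-head dec) x∈)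
delete-∉ x {r ∷ rs} dec (here x≡r)  | no r≢x   = r≢x (sym x≡r)
delete-∉ x {r ∷ rs} dec (there x∈) | no _     = delete-∉ x (Linked.tail dec) x∈

All-delete : ∀ {P : Pred ℕ 0ℓ} x {rs} → All P rs → All P (delete x rs)
All-delete x {[]}     []         = []
All-delete x {r ∷ rs} (Pr ∷ Prs) with r ≟ x
... | yes _ = Prs
... | no  _ = Pr ∷ All-delete x Prs

delete-Distinct : ∀ x {rs} → DistinctParts rs → DistinctParts (delete x rs)
delete-Distinct x (pos , dec) = All-delete x pos , delete-StrictDec dec
  where
  delete-StrictDec : ∀ {rs} → StrictDec rs → StrictDec (delete x rs)
  delete-StrictDec {[]}     dec = dec
  delete-StrictDec {r ∷ rs} dec with r ≟ x
  ... | yes _ = Linked.tail dec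
  ... | no  _ = Decreasing-∷ (All-delete x (Decreasing-head dec)) (delete-StrictDec (Linked.tail dec))

insert-Distinct : ∀ {x rs} → 1 ≤ x → DistinctParts rs → x ∉ rs → DistinctParts (insert x rs)
insert-Distinct {x} {rs} 1≤x (pos , dec) x∉rs =
  All-resp-↭ (↭-sym (insert-↭ x rs)) (1≤x ∷ pos) , insert-StrictDec dec x∉rs
  where
  insert-StrictDec : ∀ {rs} → StrictDec rs → x ∉ rs → StrictDec (insert x rs)
  insert-StrictDec {[]}     _   _    = [-]
  insert-StrictDec {r ∷ rs} dec x∉ with x <? r
  ... | yes x<r = Decreasing-∷ (All-resp-↭ (↭-sym (insert-↭ x rs)) (x<r ∷ Decreasing-head dec))
                               (insert-StrictDec (Linked.tail dec) (x∉ ∘ there))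
  ... | no  x≮r = ≤∧≢⇒< (≮⇒≥ x≮r) (λ r≡x → x∉ (here (sym r≡x))) ∷ dec

insert-∈ : ∀ x rs → x ∈ insert x rs
insert-∈ x rs = ∈-resp-↭ (↭-sym (insert-↭ x rs)) (here refl)

insert-delete : ∀ {x rs} → StrictDec rs → x ∈ rs → insert x (delete x rs) ≡ rs
insert-delete {x} {r ∷ rs} dec x∈ with r ≟ x
insert-delete {x} {r ∷ []}      _           _ | yes refl = refl
insert-delete {x} {r ∷ r′ ∷ rs} (r′<x ∷ _) _ | yes refl with x <? r′
... | yes x<r′ = contradiction x<r′ (<-asym r′<x)
... | no  _    = refl
insert-delete {x} {r ∷ rs} dec (here x≡r)  | no r≢x = contradiction (sym x≡r) r≢x
insert-delete {x} {r ∷ rs} dec (there x∈) | no _ with x <? r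
... | yes _   = cong (r ∷_) (insert-delete (Linked.tail dec) x∈)
... | no  x≮r = contradiction (All.lookup (Decreasing-head dec) x∈) x≮r

delete-insert : ∀ {x} rs → x ∉ rs → delete x (insert x rs) ≡ rs
delete-insert {x} [] _ with x ≟ x
... | yes _   = refl
... | no  x≢x = contradiction refl x≢x
delete-insert {x} (r ∷ rs) x∉ with x <? r
... | yes _ with r ≟ x
...   | yes r≡x = contradiction (here (sym r≡x)) x∉
...   | no  _   = cong (r ∷_) (delete-insert rs (x∉ ∘ there))
delete-insert {x} (r ∷ rs) x∉ | no _ with x ≟ x
...   | yes _   = refl
...   | no  x≢x = contradiction refl x≢x

countAbove-suc-∉ : ∀ t {rs} → suc t ∉ rs → countAbove t rs ≡ countAbove (suc t) rs
countAbove-suc-∉ t {rs} 1+t∉ = count-cong-local _ _ (All.map (λ 1+t≢r → (λ t<r → ≤∧≢⇒< t<r 1+t≢r) , <-trans (n<1+n t))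
                                                         (¬Any⇒All¬ rs 1+t∉))

countAbove-suc-∈ : ∀ t {rs} → StrictDec rs → suc t ∈ rs → countAbove t rs ≡ suc (countAbove (suc t) rs)
countAbove-suc-∈ t {rs} dec 1+t∈ = begin
  countAbove t rs                         ≡⟨ count-↭ (t <?_) (delete-↭ rs 1+t∈) ⟨
  countAbove t (suc t ∷ rest)             ≡⟨ count-accept (t <?_) rest ≤-refl ⟩
  suc (countAbove t rest)                 ≡⟨ cong suc (countAbove-suc-∉ t (delete-∉ (suc t) dec)) ⟩
  suc (countAbove (suc t) rest)           ≡⟨ cong suc (count-reject (suc t <?_) rest (<-irrefl refl)) ⟨
  suc (countAbove (suc t) (suc t ∷ rest)) ≡⟨ cong suc (count-↭ (suc t <?_) (delete-↭ rs 1+t∈)) ⟩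
  suc (countAbove (suc t) rs)             ∎
  where
  open ≡-Reasoning
  rest = delete (suc t) rs

record Move (Src Tgt : Pred (List ℕ) 0ℓ) (shift : ℕ) : Set where
  field
    to        : List ℕ → List ℕ
    from      : List ℕ → List ℕ
    to-maps   : ∀ {xs} → Src xs → Tgt (to xs) × sum xs ≡ shift + sum (to xs)
    from-maps : ∀ {ys} → Tgt ys → Src (from ys) × sum (from ys) ≡ shift + sum ys
    from∘to   : ∀ {xs} → Src xs → from (to xs) ≡ xs
    to∘from   : ∀ {ys} → Tgt ys → to (from ys) ≡ ys

Move-id : ∀ {P} → Move P P 0
Move-id = record
  { to = λ xs → xs ; from = λ ys → ys ; to-maps = λ Px → Px , refl ; from-maps = λ Py → Py , refl
  ; from∘to = λ _ → refl ; to∘from = λ _ → refl }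

Move-∘ : ∀ {A B C a b c} → Move A B a → Move B C b → a + b ≡ c → Move A C c
Move-∘ {a = a} {b} M N a+b≡c = record
  { to        = N.to ∘ M.to
  ; from      = M.from ∘ N.from
  ; to-maps   = λ {xs} Ax → let (Bx , sum≡) = M.to-maps Ax ; (Cx , sum≡′) = N.to-maps Bx
                            in Cx , shifted sum≡ sum≡′
  ; from-maps = λ Cy → let (By , sum≡) = N.from-maps Cy ; (Ay , sum≡′) = M.from-maps By
                       in Ay , shifted sum≡′ sum≡
  ; from∘to   = λ Ax → trans (cong M.from (N.from∘to (proj₁ (M.to-maps Ax)))) (M.from∘to Ax)
  ; to∘from   = λ Cy → trans (cong N.to (M.to∘from (proj₁ (N.from-maps Cy)))) (N.to∘from Cy)
  }
  where
  module M = Move M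
  module N = Move N
  shifted : ∀ {x y z} → x ≡ a + y → y ≡ b + z → x ≡ _ + z
  shifted {z = z} x≡ y≡ = trans x≡ (trans (cong (a +_) y≡) (trans (sym (+-assoc a b z)) (cong (_+ z) a+b≡c)))

Reds : ℕ → ℕ → Pred (List ℕ) 0ℓ
Reds t k rs = DistinctParts rs × countAbove t rs ≡ k

red-lower : ∀ t k → Move (λ rs → Reds t k rs × suc t ∉ rs) (Reds t k) k
red-lower t k = record
  { to        = map (lowerAbove t)
  ; from      = map (raiseAbove t)
  ; to-maps   = λ {rs} ((dist , #above) , 1+t∉) →
      (lowerAbove-Distinct t dist 1+t∉ , trans (countAbove-lowerAbove t 1+t∉) #above) ,
      trans (sum-lowerAbove t rs) (cong (_+ sum (map (lowerAbove t) rs)) #above)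
  ; from-maps = λ {ys} (dist , #above) →
      ((raiseAbove-Distinct t dist , trans (countAbove-raiseAbove t ys) #above) , suc-∉-raiseAbove t ys) ,
      trans (sum-raiseAbove t ys) (cong (_+ sum ys) #above)
  ; from∘to   = λ (_ , 1+t∉) → raiseAbove-lowerAbove-list t 1+t∉
  ; to∘from   = λ {ys} _ → lowerAbove-raiseAbove-list t ys
  }

red-delete : ∀ t k → Move (λ rs → Reds t (suc k) rs × suc t ∈ rs) (λ rs → Reds t k rs × suc t ∉ rs) (suc t)
red-delete t k = record
  { to        = delete (suc t)
  ; from      = insert (suc t)
  ; to-maps   = λ {rs} ((dist , #above) , 1+t∈) →
      ((delete-Distinct (suc t) dist ,
        suc-injective (trans (sym (count-accept (t <?_) _ ≤-refl)) (trans (count-↭ (t <?_) (delete-↭ rs 1+t∈)) #above))) ,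
       delete-∉ (suc t) (proj₂ dist)) ,
      sym (sum-↭ (delete-↭ rs 1+t∈))
  ; from-maps = λ {ys} ((dist , #above) , 1+t∉) →
      ((insert-Distinct (s≤s z≤n) dist 1+t∉ ,
        trans (count-↭ (t <?_) (insert-↭ (suc t) ys)) (trans (count-accept (t <?_) ys ≤-refl) (cong suc #above))) ,
       insert-∈ (suc t) ys) ,
      sum-↭ (insert-↭ (suc t) ys)
  ; from∘to   = λ ((dist , _) , 1+t∈) → insert-delete (proj₂ dist) 1+t∈
  ; to∘from   = λ {ys} (_ , 1+t∉) → delete-insert ys 1+t∉
  }

red-drop : ∀ t k → Move (λ rs → Reds t (suc k) rs × suc t ∈ rs) (Reds t k) (suc t + k)
red-drop t k = Move-∘ (red-delete t k) (red-lower t k) refl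

GreenParts : List ℕ → Set
GreenParts gs = DistinctParts gs × All Even gs

Greens : ℕ → Pred (List ℕ) 0ℓ
Greens ℓ gs = GreenParts gs × length gs ≡ ℓ

even-above-2 : ∀ {v} → 1 ≤ v → Even v → 2 ≢ v → 2 < v
even-above-2 {suc zero}          _ ()
even-above-2 {suc (suc zero)}    _ _  2≢2 = contradiction refl 2≢2
even-above-2 {suc (suc (suc _))} _ _  _   = s≤s (s≤s (s≤s z≤n))

even-∸2 : ∀ {v} → 2 ≤ v → Even v → Even (v ∸ 2)
even-∸2 {suc (suc _)} _ ev = ev

GreenParts-above-2 : ∀ gs → GreenParts gs → ¬ EndsWith 2 gs → All (2 <_) gs
GreenParts-above-2 []           _                               _     = []
GreenParts-above-2 (g ∷ [])     ((1≤g ∷ _ , _) , ev ∷ _)       not2 =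
  even-above-2 1≤g ev (not2 ∘ cong just ∘ sym) ∷ []
GreenParts-above-2 (g ∷ h ∷ gs) ((_ ∷ pos , h<g ∷ dec) , _ ∷ ev) not2
  with GreenParts-above-2 (h ∷ gs) ((pos , dec) , ev) not2
... | above@(2<h ∷ _) = <-trans 2<h h<g ∷ above

lower-2-GreenParts : ∀ {gs} → All (2 <_) gs → GreenParts gs → GreenParts (map (_∸ 2) gs)
lower-2-GreenParts above ((_ , dec) , ev) =
  (All-map⁺ (All.map (∸-monoˡ-≤ 2) above) ,
   Linked-map⁺ (_∸ 2) (λ _ 2<b b<a → ∸-monoˡ-< b<a (<⇒≤ 2<b)) above dec) ,
  All-map⁺ (All.zipWith (λ (2<g , ev) → even-∸2 (<⇒≤ 2<g) ev) (above , ev))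

raise-2-GreenParts : ∀ {gs} → GreenParts gs → GreenParts (map (2 +_) gs)
raise-2-GreenParts ((pos , dec) , ev) =
  (All-map⁺ (All.map (λ 1≤g → ≤-trans 1≤g (m≤n+m _ 2)) pos) ,
   Linked-map⁺ (2 +_) (λ _ _ → +-monoʳ-< 2) pos dec) ,
  All-map⁺ ev

raise-2-lower-2 : ∀ {gs} → All (2 ≤_) gs → map (2 +_) (map (_∸ 2) gs) ≡ gs
raise-2-lower-2 {gs} 2≤gs = trans (sym (map-∘ gs)) (map-id-local (All.map m+[n∸m]≡n 2≤gs))

lower-2-raise-2 : ∀ gs → map (_∸ 2) (map (2 +_) gs) ≡ gs
lower-2-raise-2 gs = trans (sym (map-∘ gs)) (map-id-local (All.universal (m+n∸m≡n 2) gs))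

raise-2-not-ending-2 : ∀ {gs} → All (1 ≤_) gs → ¬ EndsWith 2 (map (2 +_) gs)
raise-2-not-ending-2 {gs} pos ends with last-map⁻ (2 +_) gs ends
... | g , g-last , 2+g≡2 = <⇒≢ (All.lookup pos (last-∈ gs g-last)) (sym (+-cancelˡ-≡ 2 g 0 2+g≡2))

green-lower : ∀ ℓ → Move (λ gs → Greens ℓ gs × ¬ EndsWith 2 gs) (Greens ℓ) (2 * ℓ)
green-lower ℓ = record
  { to        = map (_∸ 2)
  ; from      = map (2 +_)
  ; to-maps   = λ {gs} ((parts , len) , not2) → let above = GreenParts-above-2 gs parts not2 in
      (lower-2-GreenParts above parts , trans (length-map (_∸ 2) gs) len) ,
      (begin
        sum gs                                           ≡⟨ cong sum (raise-2-lower-2 (All.map <⇒≤ above)) ⟨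
        sum (map (2 +_) (map (_∸ 2) gs))                 ≡⟨ sum-map-+ 2 (map (_∸ 2) gs) ⟩
        2 * length (map (_∸ 2) gs) + sum (map (_∸ 2) gs)
          ≡⟨ cong (λ m → 2 * m + sum (map (_∸ 2) gs)) (trans (length-map (_∸ 2) gs) len) ⟩
        2 * ℓ + sum (map (_∸ 2) gs)                      ∎)
  ; from-maps = λ {gs} (parts@((pos , _) , _) , len) →
      ((raise-2-GreenParts parts , trans (length-map (2 +_) gs) len) , raise-2-not-ending-2 pos) ,
      trans (sum-map-+ 2 gs) (cong (λ m → 2 * m + sum gs) len)
  ; from∘to   = λ {gs} ((parts , _) , not2) → raise-2-lower-2 (All.map <⇒≤ (GreenParts-above-2 gs parts not2))
  ; to∘from   = λ {gs} _ → lower-2-raise-2 gs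
  }
  where open ≡-Reasoning

green-drop-last : ∀ ℓ →
  Move (λ gs → Greens (suc ℓ) gs × EndsWith 2 gs) (λ gs → Greens ℓ gs × ¬ EndsWith 2 gs) 2
green-drop-last ℓ = record
  { to        = init
  ; from      = _∷ʳ 2
  ; to-maps   = λ {gs} (greens , ends) →
      let gs≡ = init-∷ʳ-last gs ends in
      dropped (init gs) (subst (Greens (suc ℓ)) (sym gs≡) greens) ,
      trans (cong sum (sym gs≡)) (trans (sum-++ (init gs) (2 ∷ [])) (+-comm _ 2))
  ; from-maps = λ {ys} ((((pos , dec) , ev) , len) , not2) →
      ((((All-∷ʳ⁺ pos (s≤s z≤n) ,
          Linked-∷ʳ⁺ dec (λ {y} y-last → All.lookup (GreenParts-above-2 ys ((pos , dec) , ev) not2) (last-∈ ys y-last))) ,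
         All-∷ʳ⁺ ev refl) ,
        trans (length-++ ys) (trans (+-comm _ 1) (cong suc len))) ,
       last-∷ʳ ys) ,
      trans (sum-++ ys (2 ∷ [])) (+-comm _ 2)
  ; from∘to   = λ {gs} (_ , ends) → init-∷ʳ-last gs ends
  ; to∘from   = λ {ys} _ → init-∷ʳ ys
  }
  where
  dropped : ∀ ys → Greens (suc ℓ) (ys ∷ʳ 2) → Greens ℓ ys × ¬ EndsWith 2 ys
  dropped ys (((pos , dec) , ev) , len) =
    (((proj₁ (All-∷ʳ⁻ pos) , Linked-∷ʳ⁻ ys dec) , proj₁ (All-∷ʳ⁻ ev)) ,
     suc-injective (trans (trans (+-comm 1 _) (sym (length-++ ys))) len)) ,
    λ ends → <-irrefl refl (All.lookup (Decreasing-above-last ys dec) (last-∈ ys ends))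

green-drop : ∀ ℓ → Move (λ gs → Greens (suc ℓ) gs × EndsWith 2 gs) (Greens ℓ) (2 * suc ℓ)
green-drop ℓ = Move-∘ (green-drop-last ℓ) (green-lower ℓ) (sym (*-suc 2 ℓ))

Split : Pred (List ℕ) 0ℓ → Pred (List ℕ) 0ℓ → ℕ → Pred (List ℕ × List ℕ) 0ℓ
Split R G n (rs , gs) = R rs × G gs × sum rs + sum gs ≡ n

Move-pair : ∀ {R R′ G G′ a b s n} → Move R R′ a → Move G G′ b → a + b ≡ s →
  Lowering (Split R G n) (λ j → Split R′ G′ j) s n
Move-pair {a = a} {b} {s} {n} M N a+b≡s = record
  { to        = λ (rs , gs) → M.to rs , N.to gs
  ; from      = λ (rs , gs) → M.from rs , N.from gs
  ; to-maps   = λ {(rs , gs)} (Rrs , Ggs , n≡) →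
      let (R′ , sum-rs) = M.to-maps Rrs ; (G′ , sum-gs) = N.to-maps Ggs in
      _ , trans (sym n≡) (regroup sum-rs sum-gs) , R′ , G′ , refl
  ; from-maps = λ {j} {(rs , gs)} n≡ (R′rs , G′gs , j≡) →
      let (R , sum-rs) = M.from-maps R′rs ; (G , sum-gs) = N.from-maps G′gs in
      R , G , trans (regroup sum-rs sum-gs) (trans (cong (s +_) j≡) (sym n≡))
  ; from∘to   = λ (Rrs , Ggs , _) → cong₂ _,_ (M.from∘to Rrs) (N.from∘to Ggs)
  ; to∘from   = λ _ (R′rs , G′gs , _) → cong₂ _,_ (M.to∘from R′rs) (N.to∘from G′gs)
  }
  where
  module M = Move M
  module N = Move N
  regroup : ∀ {x x′ y y′} → x ≡ a + x′ → y ≡ b + y′ → x + y ≡ s + (x′ + y′)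
  regroup {x′ = x′} {y′ = y′} x≡ y≡ =
    trans (cong₂ _+_ x≡ y≡) (trans (interchange a x′ b y′) (cong (_+ (x′ + y′)) a+b≡s))

IsA→Split : ∀ {n k ℓ} x → IsA n k ℓ x → Split (Reds ℓ k) (Greens ℓ) n x
IsA→Split _ (pr , sr , pg , sg , ev , sum≡ , len , #above) = ((pr , sr) , #above) , (((pg , sg) , ev) , len) , sum≡

Split→IsA : ∀ {n k ℓ} x → Split (Reds ℓ k) (Greens ℓ) n x → IsA n k ℓ x
Split→IsA _ (((pr , sr) , #above) , (((pg , sg) , ev) , len) , sum≡) = pr , sr , pg , sg , ev , sum≡ , len , #above

pairs : ℕ → List (List ℕ × List ℕ)
pairs n = cartesianProduct (subsets n) (subsets n)

IsA-enumerated : ∀ n k ℓ → Enumerates (IsA n k ℓ) (pairs n)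
IsA-enumerated n k ℓ = cartesianProduct⁺ (subsets-unique n) (subsets-unique n) , complete
  where
  complete : ∀ {x} → IsA n k ℓ x → x ∈ pairs n
  complete {rs , gs} (pr , sr , pg , sg , _ , refl , _) = ∈-cartesianProduct⁺
    (∈-subsets⁺ sr pr (All.map (λ r≤ → ≤-trans r≤ (m≤m+n (sum rs) (sum gs))) (All-≤-sum rs)))
    (∈-subsets⁺ sg pg (All.map (λ g≤ → ≤-trans g≤ (m≤n+m (sum gs) (sum rs))) (All-≤-sum gs)))

𝓐 : Family
𝓐 k ℓ n = A n k ℓ

count-lowering-𝓐 : ∀ {n k ℓ k′ ℓ′ s} {P : Pred (List ℕ × List ℕ) 0ℓ} (P? : Decidable P) → P ⊆ᵖ IsA n k ℓ →
  Lowering P (λ j → Split (Reds ℓ′ k′) (Greens ℓ′) j) s n → count P? (pairs n) ≡ lag s (𝓐 k′ ℓ′) n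
count-lowering-𝓐 {n} {k} {ℓ} {k′} {ℓ′} P? P⊆IsA low =
  count-lowering P? (λ j → isA? j k′ ℓ′) (proj₁ (IsA-enumerated n k ℓ) , proj₂ (IsA-enumerated n k ℓ) ∘ P⊆IsA)
    (λ j → IsA-enumerated j k′ ℓ′) (Lowering-⇔ (λ Px → Px) (λ Px → Px) (IsA→Split _) (Split→IsA _) low)

hasRed? : ∀ r → Decidable (λ (x : List ℕ × List ℕ) → r ∈ proj₁ x)
hasRed? r x = r ∈? proj₁ x

greenEndsWith2? : Decidable (λ (x : List ℕ × List ℕ) → EndsWith 2 (proj₂ x))
greenEndsWith2? x = endsWith? _≟_ 2 (proj₂ x)

Reds-∉ : ∀ {t k rs} → suc t ∉ rs → (Reds (suc t) k rs → Reds t k rs) × (Reds t k rs → Reds (suc t) k rs)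
Reds-∉ {t} 1+t∉ = (λ (dist , #above) → dist , trans (countAbove-suc-∉ t 1+t∉) #above)
                , (λ (dist , #above) → dist , trans (sym (countAbove-suc-∉ t 1+t∉)) #above)

Reds-∈ : ∀ {t k rs} → suc t ∈ rs → (Reds (suc t) k rs → Reds t (suc k) rs) × (Reds t (suc k) rs → Reds (suc t) k rs)
Reds-∈ {t} 1+t∈ = (λ (dist , #above) → dist , trans (countAbove-suc-∈ t (proj₂ dist) 1+t∈) (cong suc #above))
                , (λ (dist , #above) → dist , suc-injective (trans (sym (countAbove-suc-∈ t (proj₂ dist) 1+t∈)) #above))

A-count-red-lower : ∀ k ℓ n → count (isA? n (suc k) ℓ ∩? ∁? (hasRed? (suc ℓ))) (pairs n) ≡ lag (suc k) (𝓐 (suc k) ℓ) n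
A-count-red-lower k ℓ n = count-lowering-𝓐 {n = n} _ proj₁ (Lowering-⇔
  (λ {x} (isA , 1+ℓ∉) → let (R , G , sum≡) = IsA→Split x isA in (R , 1+ℓ∉) , G , sum≡)
  (λ {x} ((R , 1+ℓ∉) , G , sum≡) → Split→IsA x (R , G , sum≡) , 1+ℓ∉)
  id id (Move-pair (red-lower ℓ (suc k)) Move-id (+-identityʳ (suc k))))

A-count-red-drop : ∀ k ℓ n → count (isA? n (suc k) ℓ ∩? hasRed? (suc ℓ)) (pairs n) ≡ lag (suc k + ℓ) (𝓐 k ℓ) n
A-count-red-drop k ℓ n = count-lowering-𝓐 {n = n} _ proj₁ (Lowering-⇔
  (λ {x} (isA , 1+ℓ∈) → let (R , G , sum≡) = IsA→Split x isA in (R , 1+ℓ∈) , G , sum≡)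
  (λ {x} ((R , 1+ℓ∈) , G , sum≡) → Split→IsA x (R , G , sum≡) , 1+ℓ∈)
  id id (Move-pair (red-drop ℓ k) Move-id (trans (+-identityʳ (suc ℓ + k)) (cong suc (+-comm ℓ k)))))

A-count-green-lower : ∀ k l n → count (isA? n k (suc l) ∩? ∁? greenEndsWith2?) (pairs n) ≡ lag (2 * suc l) (𝓐 k (suc l)) n
A-count-green-lower k l n = count-lowering-𝓐 {n = n} _ proj₁ (Lowering-⇔
  (λ {x} (isA , not2) → let (R , G , sum≡) = IsA→Split x isA in R , (G , not2) , sum≡)
  (λ {x} (R , (G , not2) , sum≡) → Split→IsA x (R , G , sum≡) , not2)
  id id (Move-pair Move-id (green-lower (suc l)) refl))

A-count-green-drop : ∀ k l n →
  count ((isA? n k (suc l) ∩? greenEndsWith2?) ∩? ∁? (hasRed? (suc l))) (pairs n) ≡ lag (k + 2 * suc l) (𝓐 k l) n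
A-count-green-drop k l n = count-lowering-𝓐 {n = n} _ (proj₁ ∘ proj₁) (Lowering-⇔
  (λ {x} ((isA , ends) , 1+l∉) → let (R , G , sum≡) = IsA→Split x isA in
    (proj₁ (Reds-∉ 1+l∉) R , 1+l∉) , (G , ends) , sum≡)
  (λ {x} ((R , 1+l∉) , (G , ends) , sum≡) →
    (Split→IsA x (proj₂ (Reds-∉ 1+l∉) R , G , sum≡) , ends) , 1+l∉)
  id id (Move-pair (red-lower l k) (green-drop l) refl))

A-count-red-green-drop : ∀ k l n →
  count ((isA? n k (suc l) ∩? greenEndsWith2?) ∩? hasRed? (suc l)) (pairs n) ≡ lag (suc l + (k + 2 * suc l)) (𝓐 k l) n
A-count-red-green-drop k l n = count-lowering-𝓐 {n = n} _ (proj₁ ∘ proj₁) (Lowering-⇔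
  (λ {x} ((isA , ends) , 1+l∈) → let (R , G , sum≡) = IsA→Split x isA in
    (proj₁ (Reds-∈ 1+l∈) R , 1+l∈) , (G , ends) , sum≡)
  (λ {x} ((R , 1+l∈) , (G , ends) , sum≡) →
    (Split→IsA x (proj₂ (Reds-∈ 1+l∈) R , G , sum≡) , ends) , 1+l∈)
  id id (Move-pair (red-drop l k) (green-drop l) (+-assoc (suc l) k (2 * suc l))))

A-red-step : ∀ k ℓ n → 𝓐 (suc k) ℓ n ≡ lag (suc k) (𝓐 (suc k) ℓ) n + lag (suc k + ℓ) (𝓐 k ℓ) n
A-red-step k ℓ n = begin
  count isA ps                                             ≡⟨ count-split isA H ps ⟩
  count (isA ∩? H) ps + count (isA ∩? ∁? H) ps             ≡⟨ cong₂ _+_ (A-count-red-drop k ℓ n) (A-count-red-lower k ℓ n) ⟩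
  lag (suc k + ℓ) (𝓐 k ℓ) n + lag (suc k) (𝓐 (suc k) ℓ) n  ≡⟨ +-comm (lag (suc k + ℓ) (𝓐 k ℓ) n) _ ⟩
  lag (suc k) (𝓐 (suc k) ℓ) n + lag (suc k + ℓ) (𝓐 k ℓ) n  ∎
  where
  open ≡-Reasoning
  isA = isA? n (suc k) ℓ
  H = hasRed? (suc ℓ)
  ps = pairs n

A-green-step : ∀ k l n → 𝓐 k (suc l) n ≡
  lag (2 * suc l) (𝓐 k (suc l)) n + (lag (k + 2 * suc l) (𝓐 k l) n + lag (suc l + (k + 2 * suc l)) (𝓐 k l) n)
A-green-step k l n = begin
  count isA ps
    ≡⟨ count-split isA E ps ⟩
  count (isA ∩? E) ps + count (isA ∩? ∁? E) ps
    ≡⟨ cong (_+ count (isA ∩? ∁? E) ps) (count-split (isA ∩? E) H ps) ⟩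
  count ((isA ∩? E) ∩? H) ps + count ((isA ∩? E) ∩? ∁? H) ps + count (isA ∩? ∁? E) ps
    ≡⟨ cong₂ _+_ (cong₂ _+_ (A-count-red-green-drop k l n) (A-count-green-drop k l n)) (A-count-green-lower k l n) ⟩
  lag (suc l + c) (𝓐 k l) n + lag c (𝓐 k l) n + lag (2 * suc l) (𝓐 k (suc l)) n
    ≡⟨ reverse-sum (lag (suc l + c) (𝓐 k l) n) (lag c (𝓐 k l) n) _ ⟩
  lag (2 * suc l) (𝓐 k (suc l)) n + (lag c (𝓐 k l) n + lag (suc l + c) (𝓐 k l) n) ∎
  where
  open ≡-Reasoning
  isA = isA? n k (suc l)
  E = greenEndsWith2?
  H = hasRed? (suc l)
  ps = pairs n
  c = k + 2 * suc l
  reverse-sum : ∀ a b c → a + b + c ≡ c + (b + a)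
  reverse-sum = solve-∀

A-green-telescoped : ∀ k l n → 𝓐 k (suc l) n ≡ lag (suc l) (𝓐 k (suc l)) n + lag (k + 2 * suc l) (𝓐 k l) n
A-green-telescoped k l = <-rec (λ n → F n ≡ lag s F n + lag c G n) telescope
  where
  s = suc l
  c = k + 2 * s
  F = 𝓐 k s
  G = 𝓐 k l
  telescope : ∀ n → (∀ {j} → j < n → F j ≡ lag s F j + lag c G j) → F n ≡ lag s F n + lag c G n
  telescope n IH = begin
    F n                                              ≡⟨ A-green-step k l n ⟩
    lag (2 * s) F n + (lag c G n + lag (s + c) G n)  ≡⟨ swap-last (lag (2 * s) F n) (lag c G n) _ ⟩
    lag (2 * s) F n + lag (s + c) G n + lag c G n    ≡⟨ cong (_+ lag c G n) lag-s-F ⟨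
    lag s F n + lag c G n                            ∎
    where
    open ≡-Reasoning
    swap-last : ∀ a b d → a + (b + d) ≡ a + d + b
    swap-last = solve-∀
    lag-s-F : lag s F n ≡ lag (2 * s) F n + lag (s + c) G n
    lag-s-F = begin
      lag s F n                                   ≡⟨ lag-cong-< s n (s≤s z≤n) (λ j j<n → IH j<n) ⟩
      lag s (λ j → lag s F j + lag c G j) n       ≡⟨ lag-distrib-+ s (lag s F) (lag c G) n ⟩
      lag s (lag s F) n + lag s (lag c G) n       ≡⟨ cong₂ _+_ (lag-lag s s F n) (lag-lag s c G n) ⟩
      lag (s + s) F n + lag (s + c) G n
        ≡⟨ cong (λ t → lag t F n + lag (s + c) G n) (cong (s +_) (sym (+-identityʳ s))) ⟩
      lag (2 * s) F n + lag (s + c) G n           ∎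

A-recurrence : SatisfiesRecurrence 𝓐
A-recurrence = record { initial-zero = refl ; initial-suc = no-empty ; step = step }
  where
  no-empty : ∀ n → 𝓐 0 0 (suc n) ≡ 0
  no-empty n = count-none _ (pairs (suc n)) λ where
    ([] , [])       (_ , _ , _ , _ , _ , () , _)
    ([] , _ ∷ _)    (_ , _ , _ , _ , _ , _ , () , _)
    (r ∷ rs , _)    (1≤r ∷ _ , _ , _ , _ , _ , _ , _ , #above) →
      1+n≢0 (trans (sym (count-accept (0 <?_) rs 1≤r)) #above)
  step : ∀ k ℓ n → 𝓐 k ℓ n ≡ recurrence 𝓐 k ℓ n
  step zero    zero    n = sym (trans (+-identityʳ _) (+-identityʳ _))
  step zero    (suc l) n = trans (A-green-telescoped 0 l n) (sym (+-identityʳ _))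
  step (suc k) zero    n = trans (A-red-step k 0 n) (cong (_+ lag (suc k + 0) (𝓐 k 0) n)
    (trans (cong (λ t → lag t (𝓐 (suc k) 0) n) (sym (+-identityʳ (suc k)))) (sym (+-identityʳ _))))
  step (suc k) (suc l) n = begin
    𝓐 K s n                                                     ≡⟨ A-red-step k s n ⟩
    lag K (𝓐 K s) n + lag (K + s) (𝓐 k s) n                     ≡⟨ cong (_+ lag (K + s) (𝓐 k s) n) lag-K ⟩
    lag (K + s) (𝓐 K s) n + lag (2 * (K + s)) (𝓐 K l) n + lag (K + s) (𝓐 k s) n ∎
    where
    open ≡-Reasoning
    K = suc k
    s = suc l
    shift≡ : ∀ K s → K + (K + 2 * s) ≡ 2 * (K + s)
    shift≡ = solve-∀
    lag-K : lag K (𝓐 K s) n ≡ lag (K + s) (𝓐 K s) n + lag (2 * (K + s)) (𝓐 K l) n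
    lag-K = begin
      lag K (𝓐 K s) n                                              ≡⟨ lag-cong K n (A-green-telescoped K l) ⟩
      lag K (λ j → lag s (𝓐 K s) j + lag (K + 2 * s) (𝓐 K l) j) n
        ≡⟨ lag-distrib-+ K (lag s (𝓐 K s)) (lag (K + 2 * s) (𝓐 K l)) n ⟩
      lag K (lag s (𝓐 K s)) n + lag K (lag (K + 2 * s) (𝓐 K l)) n
        ≡⟨ cong₂ _+_ (lag-lag K s (𝓐 K s) n) (lag-lag K (K + 2 * s) (𝓐 K l) n) ⟩
      lag (K + s) (𝓐 K s) n + lag (K + (K + 2 * s)) (𝓐 K l) n
        ≡⟨ cong (λ t → lag (K + s) (𝓐 K s) n + lag t (𝓐 K l) n) (shift≡ K s) ⟩
      lag (K + s) (𝓐 K s) n + lag (2 * (K + s)) (𝓐 K l) n          ∎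

theorem1p4 : (n k ℓ : ℕ) → L 1 n k ℓ ≡ A n k ℓ
theorem1p4 n k ℓ = recurrence-unique L-recurrence A-recurrence n k ℓ
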